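{- Let $\mathcal{F}=\{z\in\Omega:|z|=|z|_i\ge1\}$. For $z\in\mathcal{F}\cap k_{\infty^2}$, one has $\overline{\lambda}(z)=v_n$ if and only if $n=\log_q|z|$.
   Context: $q$ odd prime power, $A=\mathbb{F}_q[T]$, $k_\infty=\mathbb{F}_q((T^{ -1}))$, $\mathcal{O}_\infty=\mathbb{F}_q[[T^{ -1}]]$, $k_{\infty^2}=\mathbb{F}_{q^2}((T^{ -1}))$, $|T|=q$, $\Omega=\mathbb{C}_\infty\smallsetminus k_\infty$, $|z|_i=\min_{w\in k_\infty}|z-w|$. $\Gamma=\mathrm{PGL}_2(A)$. $\mathcal{T}$ is the Bruhat–Tits tree of $\mathrm{PGL}_2(k_\infty)$ (vertices: homothety classes of rank-2 $\mathcal{O}_\infty$-lattices in $k_\infty^2$); $\Gamma\backslash\mathcal{T}$ is a ray with vertices $v_n$, $v_n$ the $\Gamma$-orbit of $[\mathrm{diag}(T^n,1)\mathcal{O}_\infty^2]$. Fix $\mathbf{i}\in\mathbb{F}_{q^2}$ with $\mathbf{i}^2$ a non-square in $\mathbb{F}_q^\times$. For $z\in k_{\infty^2}\smallsetminus k_\infty$, write $z=g\cdot\mathbf{i}$ with $g\in\mathrm{PGL}_2(k_\infty)$; $\lambda(z)=[g\mathcal{O}_\infty^2]$ and $\overline\lambda(z)$ is its image in $\Gamma\backslash\mathcal{T}$. -}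

module Defs where

open import Level using (0ℓ)
open import Data.Nat using (ℕ; zero; suc; _%_)
open import Data.Integer as ℤ using (ℤ; +_; -[1+_]; _⊓_; _<_)
open import Data.Fin using (Fin)
open import Data.Product using (Σ; _×_; _,_; ∃)
open import Relation.Binary.PropositionalEquality using (_≡_; _≢_)
open import Relation.Nullary using (¬_)
open import Algebra.Structures using (IsCommutativeRing)
open import Function.Bundles using (_↔_; _⇔_)

record FiniteOddField : Set₁ where
  field
    Carrier : Set
    _+_ _*_ : Carrier → Carrier → Carrier
    -_      : Carrier → Carrier
    0# 1#   : Carrier
    isCommutativeRing : IsCommutativeRing _≡_ _+_ _*_ -_ 0# 1#
    0≢1     : 0# ≢ 1#
    inverse : ∀ x → x ≢ 0# → ∃ λ y → x * y ≡ 1#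
    q       : ℕ
    card    : Carrier ↔ Fin q
    q-odd   : q % 2 ≡ 1

-- Everything below is relative to F = F_q and a non-square ε = i² ∈ F_q^×,
-- so that F_{q²} = F_q(i).
module Over (F : FiniteOddField) (ε : FiniteOddField.Carrier F) where
  open FiniteOddField F

  sumTo : ℕ → (ℕ → Carrier) → Carrier
  sumTo zero    f = f 0
  sumTo (suc n) f = sumTo n f + f (suc n)

  -- Laurent series in T⁻¹ over F_q (elements of k_∞):
  --   x = Σ_{n ≥ 0} c n · T^{-(lo + n)}
  record LS : Set where
    constructor mkLS
    field
      lo : ℤ
      c  : ℕ → Carrier
  open LS public

  -- coef x k = coefficient of T^{-k} in x
  coef : LS → ℤ → Carrier
  coef x k with k ℤ.- lo x
  ... | + n      = c x n
  ... | -[1+ n ] = 0#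

  _≋_ : LS → LS → Set
  x ≋ y = ∀ k → coef x k ≡ coef y k

  0ₛ : LS
  0ₛ = mkLS (+ 0) (λ _ → 0#)

  const : Carrier → LS
  const a = mkLS (+ 0) λ { zero → a ; (suc _) → 0# }

  Tpow : ℕ → LS
  Tpow n = mkLS (ℤ.- (+ n)) λ { zero → 1# ; (suc _) → 0# }

  _+ₛ_ : LS → LS → LS
  x +ₛ y = mkLS l (λ n → coef x (l ℤ.+ + n) + coef y (l ℤ.+ + n))
    where l = lo x ⊓ lo y

  -ₛ_ : LS → LS
  -ₛ x = mkLS (lo x) (λ n → - c x n)

  _-ₛ_ : LS → LS → LS
  x -ₛ y = x +ₛ (-ₛ y)

  _*ₛ_ : LS → LS → LS
  x *ₛ y = mkLS (lo x ℤ.+ lo y)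
    (λ n → sumTo n (λ t → c x t * c y (n Data.Nat.∸ t)))

  -- valuation of an element of k_∞ : v(x) = m  (|x| = q^{-m})
  HasValₛ : LS → ℤ → Set
  HasValₛ x m = (coef x m ≢ 0#) × (∀ k → k < m → coef x k ≡ 0#)

  -- O_∞ = F_q[[T⁻¹]]  and  A = F_q[T]
  InO : LS → Set
  InO x = ∀ k → k < + 0 → coef x k ≡ 0#

  InA : LS → Set
  InA x = ∀ k → + 0 < k → coef x k ≡ 0#

  -- k_{∞²} = F_{q²}((T⁻¹)) = k_∞ ⊕ k_∞·i,  i² = ε.
  -- An element (a , b) stands for a + b·i.
  K2 : Set
  K2 = LS × LS

  re im : K2 → LS
  re (a , _) = a
  im (_ , b) = b

  _≈₂_ : K2 → K2 → Set
  (a , b) ≈₂ (a' , b') = (a ≋ a') × (b ≋ b')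

  _+₂_ : K2 → K2 → K2
  (a , b) +₂ (a' , b') = (a +ₛ a') , (b +ₛ b')

  _-₂_ : K2 → K2 → K2
  (a , b) -₂ (a' , b') = (a -ₛ a') , (b -ₛ b')

  _*₂_ : K2 → K2 → K2
  (a , b) *₂ (a' , b') =
    ((a *ₛ a') +ₛ (const ε *ₛ (b *ₛ b'))) , ((a *ₛ b') +ₛ (b *ₛ a'))

  emb : LS → K2
  emb w = w , 0ₛ

  InKinf : K2 → Set
  InKinf z = Σ LS λ w → z ≈₂ emb w

  -- valuation on k_{∞²}: v(z) = m, i.e. |z| = q^{-m}, where the
  -- coefficient of T^{-k} in F_{q²} is (coef a k) + (coef b k)·i
  HasVal : K2 → ℤ → Set
  HasVal (a , b) m =
    ¬ ((coef a m ≡ 0#) × (coef b m ≡ 0#))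
    × (∀ k → k < m → (coef a k ≡ 0#) × (coef b k ≡ 0#))

  -- |z|_i = min_{w ∈ k_∞} |z - w| = q^{-m}
  -- (minimum of absolute values = maximum of valuations)
  IsImagVal : K2 → ℤ → Set
  IsImagVal z m =
    (Σ LS λ w → HasVal (z -₂ emb w) m)
    × (∀ w m' → HasVal (z -₂ emb w) m' → m' ℤ.≤ m)

  record M2 : Set where
    constructor mat
    field
      a₁₁ a₁₂ a₂₁ a₂₂ : LS
  open M2 public

  V2 : Set
  V2 = LS × LS

  _≋ᵥ_ : V2 → V2 → Set
  (x , y) ≋ᵥ (x' , y') = (x ≋ x') × (y ≋ y')

  det : M2 → LS
  det g = (a₁₁ g *ₛ a₂₂ g) -ₛ (a₁₂ g *ₛ a₂₁ g)

  _·ᵥ_ : M2 → V2 → V2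
  g ·ᵥ (x , y) = ((a₁₁ g *ₛ x) +ₛ (a₁₂ g *ₛ y)) , ((a₂₁ g *ₛ x) +ₛ (a₂₂ g *ₛ y))

  _·ₘ_ : M2 → M2 → M2
  g ·ₘ h = mat ((a₁₁ g *ₛ a₁₁ h) +ₛ (a₁₂ g *ₛ a₂₁ h))
               ((a₁₁ g *ₛ a₁₂ h) +ₛ (a₁₂ g *ₛ a₂₂ h))
               ((a₂₁ g *ₛ a₁₁ h) +ₛ (a₂₂ g *ₛ a₂₁ h))
               ((a₂₁ g *ₛ a₁₂ h) +ₛ (a₂₂ g *ₛ a₂₂ h))

  scaleM : LS → M2 → M2
  scaleM s g = mat (s *ₛ a₁₁ g) (s *ₛ a₁₂ g) (s *ₛ a₂₁ g) (s *ₛ a₂₂ g)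

  diagT : ℕ → M2
  diagT n = mat (Tpow n) 0ₛ 0ₛ (const 1#)

  GL2k : M2 → Set
  GL2k g = ¬ (det g ≋ 0ₛ)

  -- γ ∈ GL₂(A)  (entries in A, determinant in A^× = F_q^×)
  GL2A : M2 → Set
  GL2A γ = InA (a₁₁ γ) × InA (a₁₂ γ) × InA (a₂₁ γ) × InA (a₂₂ γ)
         × (Σ Carrier λ u → (u ≢ 0#) × (det γ ≋ const u))

  InLat : M2 → V2 → Set
  InLat g w = Σ V2 λ x → InO (x .Data.Product.proj₁) × InO (x .Data.Product.proj₂)
                        × ((g ·ᵥ x) ≋ᵥ w)

  -- Möbius action: g·i = z, i.e. (a₁₁ i + a₁₂) = z (a₂₁ i + a₂₂)
  ActsI : M2 → K2 → Set
  ActsI g z = (z *₂ (a₂₂ g , a₂₁ g)) ≈₂ (a₁₂ g , a₁₁ g)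

  -- λ̄(z) = v_n : for some g ∈ GL₂(k_∞) with z = g·i, the vertex
  -- λ(z) = [g O_∞²] lies in the Γ-orbit of [diag(T^n,1) O_∞²], i.e.
  -- γ·(g O_∞²) = c·diag(T^n,1) O_∞² for some γ ∈ GL₂(A), c ∈ k_∞^×.
  LambdaBarIs : K2 → ℕ → Set
  LambdaBarIs z n =
    Σ M2 λ g → GL2k g × ActsI g z ×
    (Σ M2 λ γ → GL2A γ × (Σ LS λ s → ¬ (s ≋ 0ₛ) ×
       (∀ w → InLat (γ ·ₘ g) w ⇔ InLat (scaleM s (diagT n)) w)))

module Submission where

-- Write z = a + b·i and m = v(z), so |z| = q^{-m} with m ≤ 0; |z| = |z|_i means |a| ≤ |b| = |z|.
--
-- If n = -m, then g = (b a ; 0 1) maps i to z and g = diag(T^n,1)·(u v ; 0 1) with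
-- u = T^{-n} b ∈ O_∞^× and v = T^{-n} a ∈ O_∞, so λ(z) = [diag(T^n,1) O_∞²] = v_n.
--
-- Conversely let g·i = z and γ g O_∞² = s·diag(T^n,1) O_∞² with γ = (· · ; c d) ∈ GL₂(A), and
-- put h = γ g. Then h = s·diag(T^n,1)·k with k ∈ GL₂(O_∞), whose bottom row is primitive; as
-- x² - ε y² is anisotropic, v(N(j(h,i))) = 2v(s) = v(det h) + n, where j(h,i) = h₂₁ i + h₂₂ and
-- N is the norm of k_{∞²}/k_∞. On the other hand det h = det γ · b · N(j(g,i)) and
-- j(h,i) = j(γ,z) j(g,i), whence v(N(cz + d)) = m + n. Either c = 0, so d ∈ F_q^× and m + n = 0;
-- or |cz + d| ≥ |c b| ≥ |b|, so m + n ≤ 2m, which with m ≤ 0 ≤ n forces n = m = 0.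
--
-- Valuations of nonzero Laurent series exist only classically, so the argument runs in the
-- double-negation monad and ends in a decidable equation.

open import Defs
open import Level using (0ℓ)
open import Algebra using (CommutativeRing; RawRing; AbelianGroup)
import Algebra.Consequences.Setoid as Consequences
open import Algebra.Solver.Ring.AlmostCommutativeRing using (_-Raw-AlmostCommutative⟶_; fromCommutativeRing)
open import Data.Empty using (⊥-elim)
import Data.Fin as Fin
open import Data.Integer as ℤ using (ℤ; +_; -[1+_])
import Data.Integer.Properties as ℤₚ
import Data.Integer.Tactic.RingSolver as ℤ-Solver
open import Data.Maybe using (Maybe; just; nothing)
open import Data.Nat as ℕ using (ℕ; zero; suc; _∸_; z≤n; s≤s)
import Data.Nat.Properties as ℕₚ
open import Data.Product using (Σ; _×_; _,_; proj₁; proj₂; ∃)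
open import Data.Product.Properties using (≡-dec)
open import Data.Sum using (_⊎_; inj₁; inj₂)
open import Effect.Monad using (RawMonad)
open import Function using (_∘_)
open import Function.Bundles using (_⇔_; Equivalence; mk⇔)
open import Function.Properties.Inverse using (↔⇒↣)
open import Relation.Binary.Bundles using (Setoid)
open import Relation.Binary.Definitions using (DecidableEquality; tri<; tri≈; tri>)
open import Relation.Binary.PropositionalEquality as ≡
  using (_≡_; _≢_; refl; sym; trans; cong; cong₂; subst; subst₂)
import Relation.Binary.Reasoning.Setoid as SetoidReasoning
open import Relation.Nullary using (¬_; Dec; yes; no)
open import Relation.Nullary.Decidable using (via-injection; decidable-stable; ¬¬-excluded-middle)
open import Relation.Nullary.Negation using (¬¬-Monad; contradiction)
open import Relation.Nullary.Negation.Core using (DoubleNegation; Stable; negated-stable; ¬¬-map)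


module IntegerCoefficientSolver {c ℓ} (R : CommutativeRing c ℓ) where
  open CommutativeRing R hiding (zero) renaming (refl to ≈-refl; sym to ≈-sym; trans to ≈-trans)
  open import Algebra.Properties.Semiring.Mult.TCOptimised semiring
    using (1+×; ×-homo-+; ×1-homo-*) renaming (_×_ to _·_)
  open import Algebra.Properties.Ring ring using (⁻¹-anti-homo‿-; x[y-z]≈xy-xz; [y-z]x≈yx-zx)
  open import Algebra.Properties.AbelianGroup +-abelianGroup using (⁻¹-∙-comm; ε⁻¹≈ε)
  open import Algebra.Properties.CommutativeSemigroup +-commutativeSemigroup using (interchange)
  open import Relation.Binary.Reasoning.Setoid setoid

  -- Integer coefficients as differences a − b of naturals; reduce keeps one side zero so that
  -- equal integers are syntactically equal, as the solver's normal forms require.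
  Diff : Set
  Diff = ℕ × ℕ

  reduce : ℕ → ℕ → Diff
  reduce (suc a) (suc b) = reduce a b
  reduce a       b       = a , b

  ι : ℕ → Carrier
  ι n = n · 1#

  -- Defined by cases so that the constants 0 and 1 evaluate to 0# and 1# definitionally.
  ⟦_⟧ : Diff → Carrier
  ⟦ a , zero  ⟧ = ι a
  ⟦ a , suc b ⟧ = ι a - ι (suc b)

  private
    ⟦⟧≈ι-ι : ∀ a b → ⟦ a , b ⟧ ≈ ι a - ι b
    ⟦⟧≈ι-ι a zero    = ≈-sym (≈-trans (+-congˡ ε⁻¹≈ε) (+-identityʳ (ι a)))
    ⟦⟧≈ι-ι a (suc b) = ≈-refl

    -+-interchange : ∀ x y z w → (x + y) - (z + w) ≈ (x - z) + (y - w)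
    -+-interchange x y z w = begin
      (x + y) - (z + w)      ≈⟨ +-congˡ (⁻¹-∙-comm z w) ⟨
      (x + y) + (- z + - w)  ≈⟨ interchange x y (- z) (- w) ⟩
      (x - z) + (y - w)      ∎

    -*-expand : ∀ a b c d → (a - b) * (c - d) ≈ (a * c + b * d) - (a * d + b * c)
    -*-expand a b c d = begin
      (a - b) * (c - d)                          ≈⟨ [y-z]x≈yx-zx (c - d) a b ⟩
      a * (c - d) - b * (c - d)                  ≈⟨ +-cong (x[y-z]≈xy-xz a c d) (-‿cong (x[y-z]≈xy-xz b c d)) ⟩
      (a * c - a * d) - (b * c - b * d)          ≈⟨ +-congˡ (⁻¹-anti-homo‿- (b * c) (b * d)) ⟩
      (a * c - a * d) + (b * d - b * c)          ≈⟨ interchange (a * c) (- (a * d)) (b * d) (- (b * c)) ⟩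
      (a * c + b * d) + (- (a * d) + - (b * c))  ≈⟨ +-congˡ (⁻¹-∙-comm (a * d) (b * c)) ⟩
      (a * c + b * d) - (a * d + b * c)          ∎

    ⟦reduce⟧ : ∀ a b → ⟦ reduce a b ⟧ ≈ ι a - ι b
    ⟦reduce⟧ (suc a) (suc b) = begin
      ⟦ reduce a b ⟧                 ≈⟨ ⟦reduce⟧ a b ⟩
      ι a - ι b                      ≈⟨ +-identityˡ _ ⟨
      0# + (ι a - ι b)               ≈⟨ +-congʳ (-‿inverseʳ 1#) ⟨
      (1# - 1#) + (ι a - ι b)        ≈⟨ -+-interchange 1# (ι a) 1# (ι b) ⟨
      (1# + ι a) - (1# + ι b)        ≈⟨ +-cong (1+× a 1#) (-‿cong (1+× b 1#)) ⟨
      ι (suc a) - ι (suc b)          ∎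
    ⟦reduce⟧ zero    b    = ⟦⟧≈ι-ι zero b
    ⟦reduce⟧ (suc a) zero = ⟦⟧≈ι-ι (suc a) zero

    ι-homo-*+* : ∀ a c b d → ι (a ℕ.* c ℕ.+ b ℕ.* d) ≈ ι a * ι c + ι b * ι d
    ι-homo-*+* a c b d = ≈-trans (×-homo-+ 1# (a ℕ.* c) (b ℕ.* d)) (+-cong (×1-homo-* a c) (×1-homo-* b d))

  Diff-rawRing : RawRing _ _
  Diff-rawRing = record
    { Carrier = Diff
    ; _≈_ = _≡_
    ; _+_ = λ { (a , b) (c , d) → reduce (a ℕ.+ c) (b ℕ.+ d) }
    ; _*_ = λ { (a , b) (c , d) → reduce (a ℕ.* c ℕ.+ b ℕ.* d) (a ℕ.* d ℕ.+ b ℕ.* c) }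
    ; -_ = λ { (a , b) → b , a }
    ; 0# = 0 , 0
    ; 1# = 1 , 0
    }

  ⟦⟧-morphism : Diff-rawRing -Raw-AlmostCommutative⟶ fromCommutativeRing R
  ⟦⟧-morphism = record
    { ⟦_⟧    = ⟦_⟧
    ; +-homo = λ { (a , b) (c , d) → begin
        ⟦ reduce (a ℕ.+ c) (b ℕ.+ d) ⟧       ≈⟨ ⟦reduce⟧ (a ℕ.+ c) (b ℕ.+ d) ⟩
        ι (a ℕ.+ c) - ι (b ℕ.+ d)            ≈⟨ +-cong (×-homo-+ 1# a c) (-‿cong (×-homo-+ 1# b d)) ⟩
        (ι a + ι c) - (ι b + ι d)            ≈⟨ -+-interchange _ _ _ _ ⟩
        (ι a - ι b) + (ι c - ι d)            ≈⟨ +-cong (⟦⟧≈ι-ι a b) (⟦⟧≈ι-ι c d) ⟨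
        ⟦ a , b ⟧ + ⟦ c , d ⟧                 ∎ }
    ; *-homo = λ { (a , b) (c , d) → begin
        ⟦ reduce (a ℕ.* c ℕ.+ b ℕ.* d) (a ℕ.* d ℕ.+ b ℕ.* c) ⟧
          ≈⟨ ⟦reduce⟧ (a ℕ.* c ℕ.+ b ℕ.* d) (a ℕ.* d ℕ.+ b ℕ.* c) ⟩
        ι (a ℕ.* c ℕ.+ b ℕ.* d) - ι (a ℕ.* d ℕ.+ b ℕ.* c)
          ≈⟨ +-cong (ι-homo-*+* a c b d) (-‿cong (ι-homo-*+* a d b c)) ⟩
        (ι a * ι c + ι b * ι d) - (ι a * ι d + ι b * ι c)      ≈⟨ -*-expand _ _ _ _ ⟨
        (ι a - ι b) * (ι c - ι d)                              ≈⟨ *-cong (⟦⟧≈ι-ι a b) (⟦⟧≈ι-ι c d) ⟨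
        ⟦ a , b ⟧ * ⟦ c , d ⟧                                   ∎ }
    ; -‿homo = λ { (a , b) → begin
        ⟦ b , a ⟧        ≈⟨ ⟦⟧≈ι-ι b a ⟩
        ι b - ι a        ≈⟨ ⁻¹-anti-homo‿- (ι a) (ι b) ⟨
        - (ι a - ι b)    ≈⟨ -‿cong (⟦⟧≈ι-ι a b) ⟨
        - ⟦ a , b ⟧      ∎ }
    ; 0-homo = ≈-refl
    ; 1-homo = ≈-refl
    }

  _≟-coeff_ : ∀ x y → Maybe (⟦ x ⟧ ≈ ⟦ y ⟧)
  x ≟-coeff y with ≡-dec ℕₚ._≟_ ℕₚ._≟_ x y
  ... | yes ≡.refl = just ≈-refl
  ... | no _       = nothing

  open import Algebra.Solver.Ring Diff-rawRing (fromCommutativeRing R) ⟦⟧-morphism _≟-coeff_ public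
    using (solve; _:=_; _:+_; _:*_; :-_; _:-_; con; Polynomial)

  :0 :1 : ∀ {n} → Polynomial n
  :0 = con (0 , 0)
  :1 = con (1 , 0)


private
  k≡l+[k-l] : ∀ k l → k ≡ l ℤ.+ (k ℤ.- l)
  k≡l+[k-l] = ℤ-Solver.solve-∀

  [l+n]-l≡n : ∀ l n → (l ℤ.+ n) ℤ.- l ≡ n
  [l+n]-l≡n = ℤ-Solver.solve-∀

  +-interchange : ∀ e f a b → (e ℤ.+ a) ℤ.+ (f ℤ.+ b) ≡ e ℤ.+ f ℤ.+ (a ℤ.+ b)
  +-interchange = ℤ-Solver.solve-∀

  regroup : ∀ e f a b n → e ℤ.+ f ℤ.+ ((a ℤ.+ b) ℤ.+ n) ≡ (e ℤ.+ a) ℤ.+ (f ℤ.+ b) ℤ.+ n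
  regroup = ℤ-Solver.solve-∀

  n≡[m+n]-m : ∀ m n → n ≡ (m ℤ.+ n) ℤ.+ ℤ.- m
  n≡[m+n]-m = ℤ-Solver.solve-∀

  +-cancelˡ-≡ : ∀ a {b c} → a ℤ.+ b ≡ a ℤ.+ c → b ≡ c
  +-cancelˡ-≡ a {b} {c} = ∙-cancelˡ a b c
    where open import Algebra.Properties.Group (AbelianGroup.group ℤₚ.+-0-abelianGroup) using (∙-cancelˡ)

  f+m≤m : ∀ {f} m → f ℤ.≤ + 0 → f ℤ.+ m ℤ.≤ m
  f+m≤m m f≤0 = ℤₚ.≤-trans (ℤₚ.+-monoˡ-≤ m f≤0) (ℤₚ.≤-reflexive (ℤₚ.+-identityˡ m))

  double-≤ : ∀ {x y} → x ℤ.≤ y → x ℤ.+ x ℤ.≤ y ℤ.+ y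
  double-≤ x≤y = ℤₚ.+-mono-≤ x≤y x≤y

  nonpos-sum-zero : ∀ {x y} → x ℤ.≤ + 0 → y ℤ.≤ + 0 → x ℤ.+ y ≡ + 0 → y ≡ + 0
  nonpos-sum-zero {x} {y} x≤0 y≤0 x+y≡0 = ℤₚ.≤-antisym y≤0 (subst (+ 0 ℤ.≤_) y≡-x 0≤-x)
    where
    0≤-x : + 0 ℤ.≤ ℤ.- x
    0≤-x = ℤₚ.neg-mono-≤ x≤0
    y≡-x : ℤ.- x ≡ y
    y≡-x = sym (trans (n≡[m+n]-m x y) (trans (cong (ℤ._+ ℤ.- x) x+y≡0) (ℤₚ.+-identityˡ (ℤ.- x))))

  +-cancelˡ-< : ∀ a {b c} → a ℤ.+ b ℤ.< a ℤ.+ c → b ℤ.< c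
  +-cancelˡ-< a {b} {c} a+b<a+c with b ℤₚ.<? c
  ... | yes b<c = b<c
  ... | no  b≮c = ⊥-elim (ℤₚ.<⇒≱ a+b<a+c (ℤₚ.+-monoʳ-≤ a (ℤₚ.≮⇒≥ b≮c)))

  +-cancelˡ-≤ : ∀ a {b c} → a ℤ.+ b ℤ.≤ a ℤ.+ c → b ℤ.≤ c
  +-cancelˡ-≤ a {b} {c} a+b≤a+c with b ℤₚ.≤? c
  ... | yes b≤c = b≤c
  ... | no  b≰c = ⊥-elim (ℤₚ.<⇒≱ (ℤₚ.+-monoʳ-< a (ℤₚ.≰⇒> b≰c)) a+b≤a+c)

<⊎≡+ : ∀ e k → k ℤ.< e ⊎ Σ ℕ λ n → k ≡ e ℤ.+ + n
<⊎≡+ e k with k ℤ.- e in eq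
... | + n      = inj₂ (n , trans (k≡l+[k-l] k e) (cong (ℤ._+_ e) eq))
... | -[1+ n ] = inj₁ (subst (ℤ._< e) (sym (trans (k≡l+[k-l] k e) (cong (ℤ._+_ e) eq)))
                       (subst (e ℤ.+ -[1+ n ] ℤ.<_) (ℤₚ.+-identityʳ e) (ℤₚ.+-monoʳ-< e ℤ.-<+)))

≤⇒+ℕ : ∀ {a b} → a ℤ.≤ b → Σ ℕ λ d → a ℤ.+ + d ≡ b
≤⇒+ℕ {a} {b} a≤b with <⊎≡+ a b
... | inj₁ b<a      = ⊥-elim (ℤₚ.<⇒≱ b<a a≤b)
... | inj₂ (d , eq) = d , sym eq

⊓-gaps : ∀ e l → Σ ℕ (λ d → e ℤ.⊓ l ℤ.+ + d ≡ e) × Σ ℕ (λ d → e ℤ.⊓ l ℤ.+ + d ≡ l)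
⊓-gaps e l = ≤⇒+ℕ (ℤₚ.i⊓j≤i e l) , ≤⇒+ℕ (ℤₚ.i⊓j≤j e l)

n≡-m-from-bound : ∀ m n → m ℤ.≤ + 0 → m ℤ.+ + n ≡ + 0 ⊎ m ℤ.+ + n ℤ.≤ m ℤ.+ m → + n ≡ ℤ.- m
n≡-m-from-bound m n m≤0 (inj₁ m+n≡0) =
  trans (n≡[m+n]-m m (+ n)) (trans (cong (ℤ._+ ℤ.- m) m+n≡0) (ℤₚ.+-identityˡ (ℤ.- m)))
n≡-m-from-bound m n m≤0 (inj₂ m+n≤m+m) = subst₂ (λ i j → + i ≡ ℤ.- j) (sym n≡0) (sym m≡0) refl
  where
  n≤m : + n ℤ.≤ m
  n≤m = +-cancelˡ-≤ m m+n≤m+m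
  n≡0 : n ≡ 0
  n≡0 = ℕₚ.n≤0⇒n≡0 (ℤₚ.drop‿+≤+ (ℤₚ.≤-trans n≤m m≤0))
  m≡0 : m ≡ + 0
  m≡0 = ℤₚ.≤-antisym m≤0 (subst (λ i → + i ℤ.≤ m) n≡0 n≤m)


module _ (F : FiniteOddField) (ε : FiniteOddField.Carrier F) where
  open FiniteOddField F using (Carrier; 0#; 1#; 0≢1; inverse; card; isCommutativeRing)
  open Over F ε

  commutativeRing : CommutativeRing 0ℓ 0ℓ
  commutativeRing = record { isCommutativeRing = isCommutativeRing }

  open CommutativeRing commutativeRing
    using (_+_; _*_; -_; _-_; +-assoc; +-comm; +-identityʳ; +-identityˡ; *-comm; *-assoc;
           *-identityˡ; zeroˡ; zeroʳ; distribˡ; -‿inverseʳ; +-commutativeSemigroup)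
  open import Algebra.Properties.CommutativeSemigroup +-commutativeSemigroup using (interchange)
  module FSolver = IntegerCoefficientSolver commutativeRing
  open ≡.≡-Reasoning

  _≟_ : DecidableEquality Carrier
  _≟_ = via-injection (↔⇒↣ card) Fin._≟_

  -0#≡0# : - 0# ≡ 0#
  -0#≡0# = FSolver.solve 0 (:- :0 := :0) refl
    where open FSolver using (_:=_; :-_; :0)

  x*y≢0 : ∀ {x y} → x ≢ 0# → y ≢ 0# → x * y ≢ 0#
  x*y≢0 {x} {y} x≢0 y≢0 xy≡0 with inverse x x≢0
  ... | x⁻¹ , xx⁻¹≡1 = y≢0 (begin
    y
      ≡⟨ FSolver.solve 3 (λ x y x⁻¹ → y := y :* (:1 :- x :* x⁻¹) :+ (x :* y) :* x⁻¹) refl x y x⁻¹ ⟩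
    y * (1# - x * x⁻¹) + (x * y) * x⁻¹   ≡⟨ cong₂ (λ u v → y * (1# - u) + v * x⁻¹) xx⁻¹≡1 xy≡0 ⟩
    y * (1# - 1#) + 0# * x⁻¹             ≡⟨ FSolver.solve 2 (λ y x⁻¹ → y :* (:1 :- :1) :+ :0 :* x⁻¹ := :0) refl y x⁻¹ ⟩
    0#                                   ∎)
    where open FSolver using (_:=_; _:+_; _:*_; _:-_; :0; :1)

  x*x≡0⇒x≡0 : ∀ {x} → x * x ≡ 0# → x ≡ 0#
  x*x≡0⇒x≡0 {x} xx≡0 with x ≟ 0#
  ... | yes x≡0 = x≡0
  ... | no  x≢0 = ⊥-elim (x*y≢0 x≢0 x≢0 xx≡0)

  anisotropic : (∀ x → x * x ≢ ε) → ∀ x y → x * x - ε * (y * y) ≡ 0# → x ≡ 0# × y ≡ 0#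
  anisotropic ε-nonsquare x y N≡0 = x≡0 , y≡0
    where
    open FSolver using (_:=_; _:+_; _:*_; _:-_; :0; :1)
    square-of-y⁻¹x : ∀ y⁻¹ → y * y⁻¹ ≡ 1# → (x * y⁻¹) * (x * y⁻¹) ≡ ε
    square-of-y⁻¹x y⁻¹ yy⁻¹≡1 = begin
      (x * y⁻¹) * (x * y⁻¹)
        ≡⟨ FSolver.solve 4 (λ x y ε y⁻¹ → (x :* y⁻¹) :* (x :* y⁻¹) :=
             ε :* ((y :* y⁻¹) :* (y :* y⁻¹)) :+ (x :* x :- ε :* (y :* y)) :* (y⁻¹ :* y⁻¹)) refl x y ε y⁻¹ ⟩
      ε * ((y * y⁻¹) * (y * y⁻¹)) + (x * x - ε * (y * y)) * (y⁻¹ * y⁻¹)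
        ≡⟨ cong₂ (λ u v → ε * (u * u) + v * (y⁻¹ * y⁻¹)) yy⁻¹≡1 N≡0 ⟩
      ε * (1# * 1#) + 0# * (y⁻¹ * y⁻¹)
        ≡⟨ FSolver.solve 2 (λ ε y⁻¹ → ε :* (:1 :* :1) :+ :0 :* (y⁻¹ :* y⁻¹) := ε) refl ε y⁻¹ ⟩
      ε ∎
    y≡0 : y ≡ 0#
    y≡0 = decidable-stable (y ≟ 0#) λ y≢0 →
      ε-nonsquare (x * proj₁ (inverse y y≢0)) (square-of-y⁻¹x _ (proj₂ (inverse y y≢0)))
    x≡0 : x ≡ 0#
    x≡0 = x*x≡0⇒x≡0 (begin
      x * x
        ≡⟨ FSolver.solve 3 (λ x y ε → x :* x := (x :* x :- ε :* (y :* y)) :+ ε :* (y :* y)) refl x y ε ⟩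
      (x * x - ε * (y * y)) + ε * (y * y)     ≡⟨ cong₂ (λ u v → u + ε * (v * v)) N≡0 y≡0 ⟩
      0# + ε * (0# * 0#)                      ≡⟨ FSolver.solve 1 (λ ε → :0 :+ ε :* (:0 :* :0) := :0) refl ε ⟩
      0#                                      ∎)

  -- Finite sums

  sumTo-cong : ∀ n {f g : ℕ → Carrier} → (∀ t → t ℕ.≤ n → f t ≡ g t) → sumTo n f ≡ sumTo n g
  sumTo-cong zero    f≗g = f≗g 0 z≤n
  sumTo-cong (suc n) f≗g = cong₂ _+_ (sumTo-cong n (λ t t≤n → f≗g t (ℕₚ.m≤n⇒m≤1+n t≤n))) (f≗g (suc n) ℕₚ.≤-refl)

  sumTo-suc : ∀ n (f : ℕ → Carrier) → sumTo (suc n) f ≡ f 0 + sumTo n (λ t → f (suc t))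
  sumTo-suc zero    f = refl
  sumTo-suc (suc n) f = trans (cong (_+ f (suc (suc n))) (sumTo-suc n f)) (+-assoc _ _ _)

  sumTo-zero : ∀ n {f : ℕ → Carrier} → (∀ t → t ℕ.≤ n → f t ≡ 0#) → sumTo n f ≡ 0#
  sumTo-zero zero    f≗0 = f≗0 0 z≤n
  sumTo-zero (suc n) f≗0 =
    trans (cong₂ _+_ (sumTo-zero n (λ t t≤n → f≗0 t (ℕₚ.m≤n⇒m≤1+n t≤n))) (f≗0 (suc n) ℕₚ.≤-refl)) (+-identityʳ 0#)

  sumTo-+ : ∀ n (f g : ℕ → Carrier) → sumTo n (λ t → f t + g t) ≡ sumTo n f + sumTo n g
  sumTo-+ zero    f g = refl
  sumTo-+ (suc n) f g = trans (cong (_+ (f (suc n) + g (suc n))) (sumTo-+ n f g)) (interchange _ _ _ _)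

  sumTo-*ˡ : ∀ n a (f : ℕ → Carrier) → sumTo n (λ t → a * f t) ≡ a * sumTo n f
  sumTo-*ˡ zero    a f = refl
  sumTo-*ˡ (suc n) a f = trans (cong (_+ (a * f (suc n))) (sumTo-*ˡ n a f)) (sym (distribˡ _ _ _))

  sumTo-*ʳ : ∀ n a (f : ℕ → Carrier) → sumTo n (λ t → f t * a) ≡ sumTo n f * a
  sumTo-*ʳ n a f = trans (sumTo-cong n (λ t _ → *-comm (f t) a)) (trans (sumTo-*ˡ n a f) (*-comm a _))

  sumTo-reverse : ∀ n (f : ℕ → Carrier) → sumTo n f ≡ sumTo n (λ t → f (n ∸ t))
  sumTo-reverse zero    f = refl
  sumTo-reverse (suc n) f = sym (begin
    sumTo (suc n) (λ t → f (suc n ∸ t))     ≡⟨ sumTo-suc n _ ⟩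
    f (suc n) + sumTo n (λ t → f (n ∸ t))   ≡⟨ cong (_+_ (f (suc n))) (sumTo-reverse n f) ⟨
    f (suc n) + sumTo n f                   ≡⟨ +-comm _ _ ⟩
    sumTo n f + f (suc n)                   ∎)

  sumTo-dropZeros : ∀ d n (f : ℕ → Carrier) → (∀ t → t ℕ.< d → f t ≡ 0#) →
                    sumTo (d ℕ.+ n) f ≡ sumTo n (λ t → f (d ℕ.+ t))
  sumTo-dropZeros zero    n f f≗0 = refl
  sumTo-dropZeros (suc d) n f f≗0 = begin
    sumTo (suc (d ℕ.+ n)) f                           ≡⟨ sumTo-suc (d ℕ.+ n) f ⟩
    f 0 + sumTo (d ℕ.+ n) (λ t → f (suc t))
      ≡⟨ cong₂ _+_ (f≗0 0 (s≤s z≤n)) (sumTo-dropZeros d n _ (λ t t<d → f≗0 (suc t) (s≤s t<d))) ⟩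
    0# + sumTo n (λ t → f (suc (d ℕ.+ t)))            ≡⟨ +-identityˡ _ ⟩
    sumTo n (λ t → f (suc (d ℕ.+ t)))                 ∎

  sumTo-head : ∀ n (f : ℕ → Carrier) → (∀ t → f (suc t) ≡ 0#) → sumTo n f ≡ f 0
  sumTo-head zero    f f≗0 = refl
  sumTo-head (suc n) f f≗0 =
    trans (sumTo-suc n f) (trans (cong (_+_ (f 0)) (sumTo-zero n (λ t _ → f≗0 t))) (+-identityʳ _))

  -- Σ_{t ≤ n} Σ_{r ≤ n-t} f t r = Σ_{s ≤ n} Σ_{t ≤ s} f t (s-t): both sum over t + r ≤ n.
  sumTo-triangle : ∀ n (f : ℕ → ℕ → Carrier) →
                   sumTo n (λ t → sumTo (n ∸ t) (f t)) ≡ sumTo n (λ s → sumTo s (λ t → f t (s ∸ t)))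
  sumTo-triangle zero    f = refl
  sumTo-triangle (suc n) f = begin
    sumTo (suc n) (λ t → sumTo (suc n ∸ t) (f t))
      ≡⟨ sumTo-suc n _ ⟩
    sumTo (suc n) (f 0) + sumTo n (λ t → sumTo (n ∸ t) (f (suc t)))
      ≡⟨ cong (_+_ (sumTo (suc n) (f 0))) (sumTo-triangle n (λ t → f (suc t))) ⟩
    sumTo (suc n) (f 0) + Sq n (λ t → f (suc t))
      ≡⟨ cong (_+ Sq n (λ t → f (suc t))) (sumTo-suc n (f 0)) ⟩
    (f 0 0 + sumTo n (λ s → f 0 (suc s))) + Sq n (λ t → f (suc t))
      ≡⟨ +-assoc _ _ _ ⟩
    f 0 0 + (sumTo n (λ s → f 0 (suc s)) + Sq n (λ t → f (suc t)))
      ≡⟨ cong (_+_ (f 0 0)) (sumTo-+ n _ _) ⟨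
    f 0 0 + sumTo n (λ s → f 0 (suc s) + sumTo s (λ t → f (suc t) (s ∸ t)))
      ≡⟨ cong (_+_ (f 0 0)) (sumTo-cong n (λ s _ → sumTo-suc s _)) ⟨
    f 0 0 + sumTo n (λ s → sumTo (suc s) (λ t → f t (suc s ∸ t)))
      ≡⟨ sumTo-suc n _ ⟨
    Sq (suc n) f
      ∎
    where
    Sq : ℕ → (ℕ → ℕ → Carrier) → Carrier
    Sq n f = sumTo n (λ s → sumTo s (λ t → f t (s ∸ t)))

  -- Laurent series

  -- x ≥ᵥ e says v(x) ≥ e, i.e. |x| ≤ q^{-e}. Definitionally, InO x is x ≥ᵥ + 0 and
  -- HasValₛ x e is coef x e ≢ 0# × x ≥ᵥ e.
  infix 4 _≥ᵥ_
  _≥ᵥ_ : LS → ℤ → Set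
  x ≥ᵥ e = ∀ k → k ℤ.< e → coef x k ≡ 0#

  coef-lo+ : ∀ x n → coef x (lo x ℤ.+ + n) ≡ c x n
  coef-lo+ x n = go (lo x ℤ.+ + n) ([l+n]-l≡n (lo x) (+ n))
    where
    go : ∀ k → k ℤ.- lo x ≡ + n → coef x k ≡ c x n
    go k eq with k ℤ.- lo x
    go k refl | + _ = refl

  coef-<lo : ∀ x → x ≥ᵥ lo x
  coef-<lo x k k<lo with k ℤ.- lo x in eq
  ... | -[1+ _ ] = refl
  ... | + n      = ⊥-elim (ℤₚ.<⇒≱ k<lo (ℤₚ.≤-trans (ℤₚ.i≤i+j (lo x) (+ n)) (ℤₚ.≤-reflexive
                     (sym (trans (k≡l+[k-l] k (lo x)) (cong (ℤ._+_ (lo x)) eq))))))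

  coef-at : ∀ x {k} n → k ≡ lo x ℤ.+ + n → coef x k ≡ c x n
  coef-at x n refl = coef-lo+ x n

  ≥ᵥ-weaken : ∀ {x e e'} → e' ℤ.≤ e → x ≥ᵥ e → x ≥ᵥ e'
  ≥ᵥ-weaken e'≤e x≥e k k<e' = x≥e k (ℤₚ.<-≤-trans k<e' e'≤e)

  ≋-refl : ∀ {x} → x ≋ x
  ≋-refl k = refl

  ≋-sym : ∀ {x y} → x ≋ y → y ≋ x
  ≋-sym x≋y k = sym (x≋y k)

  ≋-trans : ∀ {x y z} → x ≋ y → y ≋ z → x ≋ z
  ≋-trans x≋y y≋z k = trans (x≋y k) (y≋z k)

  ≋-pointwise : ∀ {x y} → lo x ≡ lo y → (∀ n → c x n ≡ c y n) → x ≋ y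
  ≋-pointwise {x} {y} lo≡ c≗ k with <⊎≡+ (lo x) k
  ... | inj₁ k<lo       = trans (coef-<lo x k k<lo) (sym (coef-<lo y k (subst (k ℤ.<_) lo≡ k<lo)))
  ... | inj₂ (n , k≡)   = trans (coef-at x n k≡) (trans (c≗ n) (sym (coef-at y n (trans k≡ (cong (ℤ._+ + n) lo≡)))))

  ≋-from : ∀ {x y} e → x ≥ᵥ e → y ≥ᵥ e → (∀ n → coef x (e ℤ.+ + n) ≡ coef y (e ℤ.+ + n)) → x ≋ y
  ≋-from {x} {y} e x≥e y≥e agree k with <⊎≡+ e k
  ... | inj₁ k<e        = trans (x≥e k k<e) (sym (y≥e k k<e))
  ... | inj₂ (n , refl) = agree n

  ≥ᵥ-resp-≋ : ∀ {x y e} → x ≋ y → x ≥ᵥ e → y ≥ᵥ e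
  ≥ᵥ-resp-≋ x≋y x≥e k k<e = trans (sym (x≋y k)) (x≥e k k<e)

  ≥ᵥ-⊓ˡ : ∀ x l → x ≥ᵥ lo x ℤ.⊓ l
  ≥ᵥ-⊓ˡ x l = ≥ᵥ-weaken (ℤₚ.i⊓j≤i (lo x) l) (coef-<lo x)

  ≥ᵥ-⊓ʳ : ∀ x l → x ≥ᵥ l ℤ.⊓ lo x
  ≥ᵥ-⊓ʳ x l = ≥ᵥ-weaken (ℤₚ.i⊓j≤j l (lo x)) (coef-<lo x)

  coef-0ₛ : ∀ k → coef 0ₛ k ≡ 0#
  coef-0ₛ k with <⊎≡+ (+ 0) k
  ... | inj₁ k<0       = coef-<lo 0ₛ k k<0
  ... | inj₂ (n , k≡)  = coef-at 0ₛ n k≡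

  coef-+ₛ : ∀ x y k → coef (x +ₛ y) k ≡ coef x k + coef y k
  coef-+ₛ x y k with <⊎≡+ (lo x ℤ.⊓ lo y) k
  ... | inj₁ k<lo      = trans (coef-<lo (x +ₛ y) k k<lo) (sym (trans
        (cong₂ _+_ (coef-<lo x k (ℤₚ.<-≤-trans k<lo (ℤₚ.i⊓j≤i _ _))) (coef-<lo y k (ℤₚ.<-≤-trans k<lo (ℤₚ.i⊓j≤j _ _))))
        (+-identityʳ 0#)))
  ... | inj₂ (n , k≡)  = trans (coef-at (x +ₛ y) n k≡) (cong₂ (λ i j → coef x i + coef y j) (sym k≡) (sym k≡))

  coef--ₛ : ∀ x k → coef (-ₛ x) k ≡ - coef x k
  coef--ₛ x k with <⊎≡+ (lo x) k
  ... | inj₁ k<lo      = trans (coef-<lo (-ₛ x) k k<lo) (sym (trans (cong -_ (coef-<lo x k k<lo)) -0#≡0#))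
  ... | inj₂ (n , k≡)  = trans (coef-at (-ₛ x) n k≡) (cong -_ (sym (coef-at x n k≡)))

  coef--ₛ-sub : ∀ x y k → coef (x -ₛ y) k ≡ coef x k - coef y k
  coef--ₛ-sub x y k = trans (coef-+ₛ x (-ₛ y) k) (cong (_+_ (coef x k)) (coef--ₛ y k))

  coef-const : ∀ a k → k ≢ + 0 → coef (const a) k ≡ 0#
  coef-const a k k≢0 with <⊎≡+ (+ 0) k
  ... | inj₁ k<0             = coef-<lo (const a) k k<0
  ... | inj₂ (zero  , k≡0)   = ⊥-elim (k≢0 k≡0)
  ... | inj₂ (suc n , k≡)    = coef-at (const a) (suc n) k≡

  ≥ᵥ-+ₛ : ∀ {x y e} → x ≥ᵥ e → y ≥ᵥ e → (x +ₛ y) ≥ᵥ e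
  ≥ᵥ-+ₛ {x} {y} x≥e y≥e k k<e = trans (coef-+ₛ x y k) (trans (cong₂ _+_ (x≥e k k<e) (y≥e k k<e)) (+-identityʳ 0#))

  ≥ᵥ--ₛ : ∀ {x e} → x ≥ᵥ e → (-ₛ x) ≥ᵥ e
  ≥ᵥ--ₛ {x} x≥e k k<e = trans (coef--ₛ x k) (trans (cong -_ (x≥e k k<e)) -0#≡0#)

  cauchy : LS → LS → ℤ → ℤ → ℕ → Carrier
  cauchy x y e f n = sumTo n (λ t → coef x (e ℤ.+ + t) * coef y (f ℤ.+ + (n ∸ t)))

  cauchy-comm : ∀ x y e f n → cauchy x y e f n ≡ cauchy y x f e n
  cauchy-comm x y e f n = trans (sumTo-reverse n _) (sumTo-cong n λ t t≤n →
    trans (cong (λ s → coef x (e ℤ.+ + (n ∸ t)) * coef y (f ℤ.+ + s)) (ℕₚ.m∸[m∸n]≡n t≤n)) (*-comm _ _))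

  cauchy-dropˡ : ∀ x y e f d n → x ≥ᵥ e ℤ.+ + d → cauchy x y e f (d ℕ.+ n) ≡ cauchy x y (e ℤ.+ + d) f n
  cauchy-dropˡ x y e f d n x≥e+d = trans (sumTo-dropZeros d n _ leading-zero) (sumTo-cong n λ t _ →
    cong₂ (λ i j → coef x i * coef y (f ℤ.+ + j)) (sym (ℤₚ.+-assoc e (+ d) (+ t))) (ℕₚ.[m+n]∸[m+o]≡n∸o d n t))
    where
    leading-zero : ∀ t → t ℕ.< d → coef x (e ℤ.+ + t) * coef y (f ℤ.+ + ((d ℕ.+ n) ∸ t)) ≡ 0#
    leading-zero t t<d = trans (cong (_* _) (x≥e+d _ (ℤₚ.+-monoʳ-< e (ℤ.+<+ t<d)))) (zeroˡ _)

  cauchy-dropʳ : ∀ x y e f d n → y ≥ᵥ f ℤ.+ + d → cauchy x y e f (d ℕ.+ n) ≡ cauchy x y e (f ℤ.+ + d) n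
  cauchy-dropʳ x y e f d n y≥f+d = begin
    cauchy x y e f (d ℕ.+ n)      ≡⟨ cauchy-comm x y e f (d ℕ.+ n) ⟩
    cauchy y x f e (d ℕ.+ n)      ≡⟨ cauchy-dropˡ y x f e d n y≥f+d ⟩
    cauchy y x (f ℤ.+ + d) e n    ≡⟨ cauchy-comm y x (f ℤ.+ + d) e n ⟩
    cauchy x y e (f ℤ.+ + d) n    ∎

  cauchy-vanishes : ∀ x y e f d₁ d₂ N → x ≥ᵥ e ℤ.+ + d₁ → y ≥ᵥ f ℤ.+ + d₂ → N ℕ.< d₁ ℕ.+ d₂ →
                    cauchy x y e f N ≡ 0#
  cauchy-vanishes x y e f d₁ d₂ N x≥ y≥ N<d₁+d₂ = sumTo-zero N term-zero
    where
    term-zero : ∀ t → t ℕ.≤ N → coef x (e ℤ.+ + t) * coef y (f ℤ.+ + (N ∸ t)) ≡ 0#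
    term-zero t t≤N with t ℕ.<? d₁
    ... | yes t<d₁ = trans (cong (_* _) (x≥ _ (ℤₚ.+-monoʳ-< e (ℤ.+<+ t<d₁)))) (zeroˡ _)
    ... | no  t≮d₁ = trans (cong (_ *_) (y≥ _ (ℤₚ.+-monoʳ-< f (ℤ.+<+ N∸t<d₂)))) (zeroʳ _)
      where
      N∸t<d₂ : N ∸ t ℕ.< d₂
      N∸t<d₂ = ℕₚ.+-cancelˡ-< t (N ∸ t) d₂ (subst (ℕ._< t ℕ.+ d₂) (sym (ℕₚ.m+[n∸m]≡n t≤N))
                 (ℕₚ.<-≤-trans N<d₁+d₂ (ℕₚ.+-monoˡ-≤ d₂ (ℕₚ.≮⇒≥ t≮d₁))))

  coef-*ₛ-below-lo : ∀ x y e f d₁ d₂ → e ℤ.+ + d₁ ≡ lo x → f ℤ.+ + d₂ ≡ lo y →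
                     ∀ N → coef (x *ₛ y) (e ℤ.+ f ℤ.+ + N) ≡ cauchy x y e f N
  coef-*ₛ-below-lo x y e f d₁ d₂ refl refl N with N ℕ.<? d₁ ℕ.+ d₂
  ... | yes N<d =
    trans (coef-<lo (x *ₛ y) _ below) (sym (cauchy-vanishes x y e f d₁ d₂ N (coef-<lo x) (coef-<lo y) N<d))
    where
    below : e ℤ.+ f ℤ.+ + N ℤ.< lo x ℤ.+ lo y
    below = subst (e ℤ.+ f ℤ.+ + N ℤ.<_) (sym (+-interchange e f (+ d₁) (+ d₂)))
              (ℤₚ.+-monoʳ-< (e ℤ.+ f) (ℤ.+<+ N<d))
  ... | no N≮d = begin
    coef (x *ₛ y) (e ℤ.+ f ℤ.+ + N)
      ≡⟨ cong (λ i → coef (x *ₛ y) (e ℤ.+ f ℤ.+ + i)) N≡ ⟩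
    coef (x *ₛ y) (e ℤ.+ f ℤ.+ + ((d₁ ℕ.+ d₂) ℕ.+ n))
      ≡⟨ cong (coef (x *ₛ y)) (regroup e f (+ d₁) (+ d₂) (+ n)) ⟩
    coef (x *ₛ y) (lo x ℤ.+ lo y ℤ.+ + n)
      ≡⟨ coef-lo+ (x *ₛ y) n ⟩
    sumTo n (λ t → c x t * c y (n ∸ t))
      ≡⟨ sumTo-cong n (λ t _ → cong₂ _*_ (coef-lo+ x t) (coef-lo+ y (n ∸ t))) ⟨
    cauchy x y (lo x) (lo y) n
      ≡⟨ cauchy-dropʳ x y (lo x) f d₂ n (coef-<lo y) ⟨
    cauchy x y (lo x) f (d₂ ℕ.+ n)
      ≡⟨ cauchy-dropˡ x y e f d₁ (d₂ ℕ.+ n) (coef-<lo x) ⟨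
    cauchy x y e f (d₁ ℕ.+ (d₂ ℕ.+ n))
      ≡⟨ cong (cauchy x y e f) (trans (sym (ℕₚ.+-assoc d₁ d₂ n)) (sym N≡)) ⟩
    cauchy x y e f N
      ∎
    where
    n : ℕ
    n = N ∸ (d₁ ℕ.+ d₂)
    N≡ : N ≡ (d₁ ℕ.+ d₂) ℕ.+ n
    N≡ = sym (ℕₚ.m+[n∸m]≡n (ℕₚ.≮⇒≥ N≮d))

  -- Both sides are compared through the exponents e ⊓ lo x and f ⊓ lo y, below both bounds.
  coef-*ₛ : ∀ {x y e f} → x ≥ᵥ e → y ≥ᵥ f → ∀ n → coef (x *ₛ y) (e ℤ.+ f ℤ.+ + n) ≡ cauchy x y e f n
  coef-*ₛ {x} {y} {e} {f} x≥e y≥f n with ⊓-gaps e (lo x) | ⊓-gaps f (lo y)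
  ... | (d₁ , e₀+d₁≡e) , (d₁' , e₀+d₁'≡lo) | (d₂ , f₀+d₂≡f) , (d₂' , f₀+d₂'≡lo) = begin
    coef (x *ₛ y) (e ℤ.+ f ℤ.+ + n)
      ≡⟨ cong (λ i → coef (x *ₛ y) (i ℤ.+ + n)) (cong₂ ℤ._+_ (sym e₀+d₁≡e) (sym f₀+d₂≡f)) ⟩
    coef (x *ₛ y) ((e₀ ℤ.+ + d₁) ℤ.+ (f₀ ℤ.+ + d₂) ℤ.+ + n)
      ≡⟨ cong (coef (x *ₛ y)) (regroup e₀ f₀ (+ d₁) (+ d₂) (+ n)) ⟨
    coef (x *ₛ y) (e₀ ℤ.+ f₀ ℤ.+ + ((d₁ ℕ.+ d₂) ℕ.+ n))
      ≡⟨ coef-*ₛ-below-lo x y e₀ f₀ d₁' d₂' e₀+d₁'≡lo f₀+d₂'≡lo _ ⟩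
    cauchy x y e₀ f₀ ((d₁ ℕ.+ d₂) ℕ.+ n)
      ≡⟨ cong (cauchy x y e₀ f₀) (ℕₚ.+-assoc d₁ d₂ n) ⟩
    cauchy x y e₀ f₀ (d₁ ℕ.+ (d₂ ℕ.+ n))
      ≡⟨ cauchy-dropˡ x y e₀ f₀ d₁ (d₂ ℕ.+ n) (subst (x ≥ᵥ_) (sym e₀+d₁≡e) x≥e) ⟩
    cauchy x y (e₀ ℤ.+ + d₁) f₀ (d₂ ℕ.+ n)
      ≡⟨ cauchy-dropʳ x y (e₀ ℤ.+ + d₁) f₀ d₂ n (subst (y ≥ᵥ_) (sym f₀+d₂≡f) y≥f) ⟩
    cauchy x y (e₀ ℤ.+ + d₁) (f₀ ℤ.+ + d₂) n
      ≡⟨ cong₂ (λ i j → cauchy x y i j n) e₀+d₁≡e f₀+d₂≡f ⟩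
    cauchy x y e f n
      ∎
    where
    e₀ f₀ : ℤ
    e₀ = e ℤ.⊓ lo x
    f₀ = f ℤ.⊓ lo y

  ≥ᵥ-*ₛ : ∀ {x y e f} → x ≥ᵥ e → y ≥ᵥ f → (x *ₛ y) ≥ᵥ e ℤ.+ f
  ≥ᵥ-*ₛ {x} {y} {e} {f} x≥e y≥f k k<e+f with ⊓-gaps e (lo x) | ⊓-gaps f (lo y)
  ... | (d₁ , e₀+d₁≡e) , (d₁' , e₀+d₁'≡lo) | (d₂ , f₀+d₂≡f) , (d₂' , f₀+d₂'≡lo) with <⊎≡+ (e₀ ℤ.+ f₀) k
    where
    e₀ f₀ : ℤ
    e₀ = e ℤ.⊓ lo x
    f₀ = f ℤ.⊓ lo y
  ... | inj₁ k<e₀+f₀ =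
    coef-<lo (x *ₛ y) k (ℤₚ.<-≤-trans k<e₀+f₀ (ℤₚ.+-mono-≤ (ℤₚ.i⊓j≤j e (lo x)) (ℤₚ.i⊓j≤j f (lo y))))
  ... | inj₂ (N , refl) = trans (coef-*ₛ-below-lo x y e₀ f₀ d₁' d₂' e₀+d₁'≡lo f₀+d₂'≡lo N)
      (cauchy-vanishes x y e₀ f₀ d₁ d₂ N (subst (x ≥ᵥ_) (sym e₀+d₁≡e) x≥e) (subst (y ≥ᵥ_) (sym f₀+d₂≡f) y≥f) N<d₁+d₂)
    where
    e₀ f₀ : ℤ
    e₀ = e ℤ.⊓ lo x
    f₀ = f ℤ.⊓ lo y
    N<d₁+d₂ : N ℕ.< d₁ ℕ.+ d₂
    N<d₁+d₂ = ℤₚ.drop‿+<+ (+-cancelˡ-< (e₀ ℤ.+ f₀) (subst (e₀ ℤ.+ f₀ ℤ.+ + N ℤ.<_)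
      (trans (cong₂ ℤ._+_ (sym e₀+d₁≡e) (sym f₀+d₂≡f)) (+-interchange e₀ f₀ (+ d₁) (+ d₂)))
      k<e+f))

  coef-*ₛ-leading : ∀ {x y e f} → x ≥ᵥ e → y ≥ᵥ f → coef (x *ₛ y) (e ℤ.+ f) ≡ coef x e * coef y f
  coef-*ₛ-leading {x} {y} {e} {f} x≥e y≥f = begin
    coef (x *ₛ y) (e ℤ.+ f)                     ≡⟨ cong (coef (x *ₛ y)) (ℤₚ.+-identityʳ (e ℤ.+ f)) ⟨
    coef (x *ₛ y) (e ℤ.+ f ℤ.+ + 0)             ≡⟨ coef-*ₛ x≥e y≥f 0 ⟩
    coef x (e ℤ.+ + 0) * coef y (f ℤ.+ + 0)
      ≡⟨ cong₂ (λ i j → coef x i * coef y j) (ℤₚ.+-identityʳ e) (ℤₚ.+-identityʳ f) ⟩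
    coef x e * coef y f                         ∎

  -- The ring k_∞

  1ₛ : LS
  1ₛ = const 1#

  +ₛ-cong : ∀ {x x' y y'} → x ≋ x' → y ≋ y' → (x +ₛ y) ≋ (x' +ₛ y')
  +ₛ-cong {x} {x'} {y} {y'} x≋x' y≋y' k =
    trans (coef-+ₛ x y k) (trans (cong₂ _+_ (x≋x' k) (y≋y' k)) (sym (coef-+ₛ x' y' k)))

  -ₛ-cong : ∀ {x x'} → x ≋ x' → (-ₛ x) ≋ (-ₛ x')
  -ₛ-cong {x} {x'} x≋x' k = trans (coef--ₛ x k) (trans (cong -_ (x≋x' k)) (sym (coef--ₛ x' k)))

  +ₛ-assoc : ∀ x y z → ((x +ₛ y) +ₛ z) ≋ (x +ₛ (y +ₛ z))
  +ₛ-assoc x y z k = begin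
    coef ((x +ₛ y) +ₛ z) k              ≡⟨ trans (coef-+ₛ (x +ₛ y) z k) (cong (_+ coef z k) (coef-+ₛ x y k)) ⟩
    (coef x k + coef y k) + coef z k    ≡⟨ +-assoc _ _ _ ⟩
    coef x k + (coef y k + coef z k)    ≡⟨ trans (coef-+ₛ x (y +ₛ z) k) (cong (_+_ (coef x k)) (coef-+ₛ y z k)) ⟨
    coef (x +ₛ (y +ₛ z)) k              ∎

  +ₛ-comm : ∀ x y → (x +ₛ y) ≋ (y +ₛ x)
  +ₛ-comm x y k = trans (coef-+ₛ x y k) (trans (+-comm _ _) (sym (coef-+ₛ y x k)))

  +ₛ-identityˡ : ∀ x → (0ₛ +ₛ x) ≋ x
  +ₛ-identityˡ x k = trans (coef-+ₛ 0ₛ x k) (trans (cong (_+ coef x k) (coef-0ₛ k)) (+-identityˡ _))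

  -ₛ-inverseˡ : ∀ x → ((-ₛ x) +ₛ x) ≋ 0ₛ
  -ₛ-inverseˡ x k = begin
    coef ((-ₛ x) +ₛ x) k     ≡⟨ trans (coef-+ₛ (-ₛ x) x k) (cong (_+ coef x k) (coef--ₛ x k)) ⟩
    - coef x k + coef x k    ≡⟨ trans (+-comm _ _) (-‿inverseʳ _) ⟩
    0#                       ≡⟨ coef-0ₛ k ⟨
    coef 0ₛ k                ∎

  cauchy-cong : ∀ {x x' y y'} e f n → x ≋ x' → y ≋ y' → cauchy x y e f n ≡ cauchy x' y' e f n
  cauchy-cong e f n x≋x' y≋y' = sumTo-cong n (λ t _ → cong₂ _*_ (x≋x' (e ℤ.+ + t)) (y≋y' (f ℤ.+ + (n ∸ t))))

  *ₛ-cong : ∀ {x x' y y'} → x ≋ x' → y ≋ y' → (x *ₛ y) ≋ (x' *ₛ y')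
  *ₛ-cong {x} {x'} {y} {y'} x≋x' y≋y' = ≋-from (e ℤ.+ f)
    (≥ᵥ-*ₛ (≥ᵥ-⊓ˡ x (lo x')) (≥ᵥ-⊓ˡ y (lo y'))) (≥ᵥ-*ₛ (≥ᵥ-⊓ʳ x' (lo x)) (≥ᵥ-⊓ʳ y' (lo y))) λ n →
    trans (coef-*ₛ (≥ᵥ-⊓ˡ x (lo x')) (≥ᵥ-⊓ˡ y (lo y')) n)
      (trans (cauchy-cong e f n x≋x' y≋y') (sym (coef-*ₛ (≥ᵥ-⊓ʳ x' (lo x)) (≥ᵥ-⊓ʳ y' (lo y)) n)))
    where
    e f : ℤ
    e = lo x ℤ.⊓ lo x'
    f = lo y ℤ.⊓ lo y'

  *ₛ-comm : ∀ x y → (x *ₛ y) ≋ (y *ₛ x)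
  *ₛ-comm x y = ≋-pointwise (ℤₚ.+-comm (lo x) (lo y)) λ n → trans (sumTo-reverse n _)
    (sumTo-cong n λ t t≤n → trans (cong (λ s → c x (n ∸ t) * c y s) (ℕₚ.m∸[m∸n]≡n t≤n)) (*-comm _ _))

  *ₛ-assoc : ∀ x y z → ((x *ₛ y) *ₛ z) ≋ (x *ₛ (y *ₛ z))
  *ₛ-assoc x y z = ≋-pointwise (ℤₚ.+-assoc (lo x) (lo y) (lo z)) λ n → sym (begin
    sumTo n (λ t → c x t * sumTo (n ∸ t) (λ r → c y r * c z ((n ∸ t) ∸ r)))
      ≡⟨ sumTo-cong n (λ t _ → sumTo-*ˡ (n ∸ t) (c x t) _) ⟨
    sumTo n (λ t → sumTo (n ∸ t) (λ r → c x t * (c y r * c z ((n ∸ t) ∸ r))))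
      ≡⟨ sumTo-triangle n (λ t r → c x t * (c y r * c z ((n ∸ t) ∸ r))) ⟩
    sumTo n (λ s → sumTo s (λ t → c x t * (c y (s ∸ t) * c z ((n ∸ t) ∸ (s ∸ t)))))
      ≡⟨ sumTo-cong n (λ s s≤n → sumTo-cong s λ t t≤s →
           trans (cong (λ i → c x t * (c y (s ∸ t) * c z i)) (∸-telescope s≤n t≤s)) (sym (*-assoc _ _ _))) ⟩
    sumTo n (λ s → sumTo s (λ t → (c x t * c y (s ∸ t)) * c z (n ∸ s)))
      ≡⟨ sumTo-cong n (λ s _ → sumTo-*ʳ s (c z (n ∸ s)) _) ⟩
    sumTo n (λ s → sumTo s (λ t → c x t * c y (s ∸ t)) * c z (n ∸ s))
      ∎)
    where
    ∸-telescope : ∀ {n s t} → s ℕ.≤ n → t ℕ.≤ s → (n ∸ t) ∸ (s ∸ t) ≡ n ∸ s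
    ∸-telescope {n} {s} {t} s≤n t≤s = trans (ℕₚ.∸-+-assoc n t (s ∸ t)) (cong (n ∸_) (ℕₚ.m+[n∸m]≡n t≤s))

  *ₛ-identityˡ : ∀ x → (1ₛ *ₛ x) ≋ x
  *ₛ-identityˡ x = ≋-from (lo x) (subst ((1ₛ *ₛ x) ≥ᵥ_) (ℤₚ.+-identityˡ (lo x)) (≥ᵥ-*ₛ (coef-<lo 1ₛ) (coef-<lo x)))
    (coef-<lo x) λ n → begin
    coef (1ₛ *ₛ x) (lo x ℤ.+ + n)              ≡⟨ cong (λ i → coef (1ₛ *ₛ x) (i ℤ.+ + n)) (ℤₚ.+-identityˡ (lo x)) ⟨
    coef (1ₛ *ₛ x) (+ 0 ℤ.+ lo x ℤ.+ + n)      ≡⟨ coef-*ₛ (coef-<lo 1ₛ) (coef-<lo x) n ⟩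
    cauchy 1ₛ x (+ 0) (lo x) n                 ≡⟨ sumTo-head n _ (higher-terms-vanish n) ⟩
    1# * coef x (lo x ℤ.+ + n)                 ≡⟨ *-identityˡ _ ⟩
    coef x (lo x ℤ.+ + n)                      ∎
    where
    higher-terms-vanish : ∀ n t → coef 1ₛ (+ 0 ℤ.+ + suc t) * coef x (lo x ℤ.+ + (n ∸ suc t)) ≡ 0#
    higher-terms-vanish n t = trans (cong (_* coef x (lo x ℤ.+ + (n ∸ suc t))) (coef-const 1# (+ suc t) λ ())) (zeroˡ _)

  *ₛ-distribˡ-+ₛ : ∀ x y z → (x *ₛ (y +ₛ z)) ≋ ((x *ₛ y) +ₛ (x *ₛ z))
  *ₛ-distribˡ-+ₛ x y z = ≋-from (lo x ℤ.+ f) x[y+z]≥ xy+xz≥ λ n → begin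
    coef (x *ₛ (y +ₛ z)) (lo x ℤ.+ f ℤ.+ + n)
      ≡⟨ coef-*ₛ (coef-<lo x) (coef-<lo (y +ₛ z)) n ⟩
    cauchy x (y +ₛ z) (lo x) f n
      ≡⟨ sumTo-cong n (λ t _ →
           trans (cong (_*_ (coef x (lo x ℤ.+ + t))) (coef-+ₛ y z (f ℤ.+ + (n ∸ t)))) (distribˡ _ _ _)) ⟩
    sumTo n (λ t → coef x (lo x ℤ.+ + t) * coef y (f ℤ.+ + (n ∸ t)) + coef x (lo x ℤ.+ + t) * coef z (f ℤ.+ + (n ∸ t)))
      ≡⟨ sumTo-+ n _ _ ⟩
    cauchy x y (lo x) f n + cauchy x z (lo x) f n
      ≡⟨ cong₂ _+_ (coef-*ₛ (coef-<lo x) (≥ᵥ-⊓ˡ y (lo z)) n) (coef-*ₛ (coef-<lo x) (≥ᵥ-⊓ʳ z (lo y)) n) ⟨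
    coef (x *ₛ y) (lo x ℤ.+ f ℤ.+ + n) + coef (x *ₛ z) (lo x ℤ.+ f ℤ.+ + n)
      ≡⟨ coef-+ₛ (x *ₛ y) (x *ₛ z) (lo x ℤ.+ f ℤ.+ + n) ⟨
    coef ((x *ₛ y) +ₛ (x *ₛ z)) (lo x ℤ.+ f ℤ.+ + n)
      ∎
    where
    f : ℤ
    f = lo y ℤ.⊓ lo z
    x[y+z]≥ : (x *ₛ (y +ₛ z)) ≥ᵥ lo x ℤ.+ f
    x[y+z]≥ = ≥ᵥ-*ₛ (coef-<lo x) (coef-<lo (y +ₛ z))
    xy+xz≥ : ((x *ₛ y) +ₛ (x *ₛ z)) ≥ᵥ lo x ℤ.+ f
    xy+xz≥ k k< = trans (coef-+ₛ (x *ₛ y) (x *ₛ z) k) (trans (cong₂ _+_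
      (≥ᵥ-*ₛ (coef-<lo x) (≥ᵥ-⊓ˡ y (lo z)) k k<) (≥ᵥ-*ₛ (coef-<lo x) (≥ᵥ-⊓ʳ z (lo y)) k k<)) (+-identityʳ 0#))

  ≋-setoid : Setoid 0ℓ 0ℓ
  ≋-setoid = record
    { Carrier = LS ; _≈_ = _≋_ ; isEquivalence = record { refl = ≋-refl ; sym = ≋-sym ; trans = ≋-trans } }

  open Consequences ≋-setoid using (comm∧idˡ⇒id; comm∧invˡ⇒inv; comm∧distrˡ⇒distr)

  LSring : CommutativeRing 0ℓ 0ℓ
  LSring = record
    { Carrier = LS ; _≈_ = _≋_ ; _+_ = _+ₛ_ ; _*_ = _*ₛ_ ; -_ = -ₛ_ ; 0# = 0ₛ ; 1# = 1ₛ
    ; isCommutativeRing = record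
      { isRing = record
        { +-isAbelianGroup = record
          { isGroup = record
            { isMonoid = record
              { isSemigroup = record
                { isMagma = record { isEquivalence = Setoid.isEquivalence ≋-setoid ; ∙-cong = +ₛ-cong }
                ; assoc = +ₛ-assoc }
              ; identity = comm∧idˡ⇒id +ₛ-comm +ₛ-identityˡ }
            ; inverse = comm∧invˡ⇒inv +ₛ-comm -ₛ-inverseˡ
            ; ⁻¹-cong = -ₛ-cong }
          ; comm = +ₛ-comm }
        ; *-cong = *ₛ-cong
        ; *-assoc = *ₛ-assoc
        ; *-identity = comm∧idˡ⇒id *ₛ-comm *ₛ-identityˡ
        ; distrib = comm∧distrˡ⇒distr +ₛ-cong *ₛ-comm *ₛ-distribˡ-+ₛ }
      ; *-comm = *ₛ-comm } }

  module L = CommutativeRing LSring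
  module LSolver = IntegerCoefficientSolver LSring
  module ≋R = SetoidReasoning ≋-setoid
  open import Algebra.Properties.Ring L.ring using (x[y-z]≈xy-xz)
  open import Algebra.Properties.Group L.+-group using (x∙y⁻¹≈ε⇒x≈y; x≈y⇒x∙y⁻¹≈ε)

  -- Valuations

  open RawMonad (¬¬-Monad {0ℓ}) using (_>>=_; pure)

  hasVal-*ₛ : ∀ {x y e f} → HasValₛ x e → HasValₛ y f → HasValₛ (x *ₛ y) (e ℤ.+ f)
  hasVal-*ₛ (x≢0 , x≥e) (y≢0 , y≥f) =
    (λ xy≡0 → x*y≢0 x≢0 y≢0 (trans (sym (coef-*ₛ-leading x≥e y≥f)) xy≡0)) , ≥ᵥ-*ₛ x≥e y≥f

  hasVal-resp-≋ : ∀ {x y e} → x ≋ y → HasValₛ x e → HasValₛ y e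
  hasVal-resp-≋ {e = e} x≋y (x≢0 , x≥e) = (λ y≡0 → x≢0 (trans (x≋y e) y≡0)) , ≥ᵥ-resp-≋ x≋y x≥e

  hasVal-unique : ∀ {x e e'} → HasValₛ x e → HasValₛ x e' → e ≡ e'
  hasVal-unique {e = e} {e'} (x≢0 , x≥e) (x≢0' , x≥e') with ℤₚ.<-cmp e e'
  ... | tri< e<e' _ _ = contradiction (x≥e' e e<e') x≢0
  ... | tri≈ _ e≡e' _ = e≡e'
  ... | tri> _ _ e'<e = contradiction (x≥e e' e'<e) x≢0'

  hasVal⇒≉0 : ∀ {x e} → HasValₛ x e → ¬ (x ≋ 0ₛ)
  hasVal⇒≉0 {e = e} (x≢0 , _) x≋0 = x≢0 (trans (x≋0 e) (coef-0ₛ e))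

  ≋-stable : ∀ {x y} → Stable (x ≋ y)
  ≋-stable {x} {y} ¬¬x≋y k = decidable-stable (coef x k ≟ coef y k) (λ x≢y → ¬¬x≋y (λ x≋y → x≢y (x≋y k)))

  hasVal-stable : ∀ {x e} → Stable (HasValₛ x e)
  hasVal-stable {x} {e} ¬¬v = negated-stable (λ ¬x≢0 → ¬¬v (λ v → ¬x≢0 (proj₁ v))) ,
    λ k k<e → decidable-stable (coef x k ≟ 0#) (λ x≢0 → ¬¬v (λ v → x≢0 (proj₂ v k k<e)))

  -- A nonzero series has a first nonzero coefficient; finding it needs the
  -- classical reading, hence the double negation.
  hasVal-exists : ∀ x → ¬ (x ≋ 0ₛ) → DoubleNegation (∃ λ e → HasValₛ x e)
  hasVal-exists x x≉0 ¬val = x≉0 (λ k → trans (all-zero k) (sym (coef-0ₛ k)))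
    where
    below : ∀ n t → t ℕ.< n → c x t ≡ 0#
    below (suc n) t t<1+n with c x n ≟ 0#
    ... | no cn≢0 = ⊥-elim (¬val (lo x ℤ.+ + n , (λ cn≡0 → cn≢0 (trans (sym (coef-lo+ x n)) cn≡0)) , below-n))
      where
      below-n : x ≥ᵥ lo x ℤ.+ + n
      below-n k k<lo+n with <⊎≡+ (lo x) k
      ... | inj₁ k<lo       = coef-<lo x k k<lo
      ... | inj₂ (t , refl) = trans (coef-lo+ x t) (below n t (ℤₚ.drop‿+<+ (+-cancelˡ-< (lo x) k<lo+n)))
    ... | yes cn≡0 with t ℕ.≟ n
    ...   | yes refl = cn≡0
    ...   | no  t≢n  = below n t (ℕₚ.≤∧≢⇒< (ℕₚ.≤-pred t<1+n) t≢n)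
    all-zero : ∀ k → coef x k ≡ 0#
    all-zero k with <⊎≡+ (lo x) k
    ... | inj₁ k<lo       = coef-<lo x k k<lo
    ... | inj₂ (t , refl) = trans (coef-lo+ x t) (below (suc t) t ℕₚ.≤-refl)

  ≋0⊎hasVal : ∀ x → DoubleNegation ((x ≋ 0ₛ) ⊎ ∃ λ e → HasValₛ x e)
  ≋0⊎hasVal x = ¬¬-excluded-middle >>= λ
    { (yes x≋0) → pure (inj₁ x≋0)
    ; (no x≉0)  → hasVal-exists x x≉0 >>= λ v → pure (inj₂ v) }

  *ₛ-≉0 : ∀ {x y} → ¬ (x ≋ 0ₛ) → ¬ (y ≋ 0ₛ) → ¬ ((x *ₛ y) ≋ 0ₛ)
  *ₛ-≉0 {x} {y} x≉0 y≉0 = negated-stable do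
    (e , vx) ← hasVal-exists x x≉0
    (f , vy) ← hasVal-exists y y≉0
    pure (hasVal⇒≉0 (hasVal-*ₛ vx vy))

  *ₛ-cancelˡ : ∀ {s x y} → ¬ (s ≋ 0ₛ) → (s *ₛ x) ≋ (s *ₛ y) → x ≋ y
  *ₛ-cancelˡ {s} {x} {y} s≉0 sx≋sy = ≋-stable do
    yes x-y≋0 ← ¬¬-excluded-middle
      where no x-y≉0 → contradiction (≋-trans (x[y-z]≈xy-xz s x y) (x≈y⇒x∙y⁻¹≈ε sx≋sy)) (*ₛ-≉0 s≉0 x-y≉0)
    pure (x∙y⁻¹≈ε⇒x≈y x y x-y≋0)

  hasVal-const : ∀ {u} → u ≢ 0# → HasValₛ (const u) (+ 0)
  hasVal-const {u} u≢0 = u≢0 , coef-<lo (const u)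

  hasVal-Tpow : ∀ n → HasValₛ (Tpow n) (ℤ.- (+ n))
  hasVal-Tpow n =
    (λ c≡0 → 0≢1 (trans (sym c≡0) (coef-at (Tpow n) {ℤ.- (+ n)} 0 (sym (ℤₚ.+-identityʳ _))))) , coef-<lo (Tpow n)

  InA∧hasVal⇒≤0 : ∀ {x e} → InA x → HasValₛ x e → e ℤ.≤ + 0
  InA∧hasVal⇒≤0 {x} {e} x∈A (x≢0 , _) with e ℤₚ.≤? + 0
  ... | yes e≤0 = e≤0
  ... | no  e≰0 = contradiction (x∈A e (ℤₚ.≰⇒> e≰0)) x≢0

  hasVal-cancelˡ : ∀ {x y e f} → HasValₛ x e → HasValₛ (x *ₛ y) (e ℤ.+ f) → HasValₛ y f
  hasVal-cancelˡ {x} {y} {e} {f} vx vxy = hasVal-stable do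
    inj₂ (f' , vy) ← ≋0⊎hasVal y
      where inj₁ y≋0 → contradiction (≋-trans (*ₛ-cong (≋-refl {x}) y≋0) (L.zeroʳ x)) (hasVal⇒≉0 vxy)
    pure (subst (HasValₛ y) (+-cancelˡ-≡ e (hasVal-unique (hasVal-*ₛ vx vy) vxy)) vy)

  unitᴼ⇒hasVal0 : ∀ {x y} → x ≥ᵥ + 0 → y ≥ᵥ + 0 → (x *ₛ y) ≋ 1ₛ → HasValₛ x (+ 0)
  unitᴼ⇒hasVal0 {x} {y} x≥0 y≥0 xy≋1 = (λ x₀≡0 → 0≢1 (begin
    0#                           ≡⟨ zeroˡ _ ⟨
    0# * coef y (+ 0)            ≡⟨ cong (_* coef y (+ 0)) x₀≡0 ⟨
    coef x (+ 0) * coef y (+ 0)  ≡⟨ coef-*ₛ-leading x≥0 y≥0 ⟨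
    coef (x *ₛ y) (+ 0)          ≡⟨ xy≋1 (+ 0) ⟩
    1#                           ∎)) , x≥0

  Tneg : ℕ → LS
  Tneg n = mkLS (+ n) λ { zero → 1# ; (suc _) → 0# }

  Tpow*Tneg : ∀ n → (Tpow n *ₛ Tneg n) ≋ 1ₛ
  Tpow*Tneg n = ≋-pointwise (ℤₚ.+-inverseˡ (+ n)) λ
    { zero    → *-identityˡ 1#
    ; (suc k) → trans (sumTo-suc k _) (trans (cong₂ _+_ (zeroʳ 1#) (sumTo-zero k (λ t _ → zeroˡ _))) (+-identityʳ 0#)) }

  hasVal-Tneg : ∀ n → HasValₛ (Tneg n) (+ n)
  hasVal-Tneg n =
    (λ c≡0 → 0≢1 (trans (sym c≡0) (coef-at (Tneg n) {+ n} 0 (sym (ℤₚ.+-identityʳ _))))) , coef-<lo (Tneg n)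

  *ₛ-cancel-inverse : ∀ {p q} → (p *ₛ q) ≋ 1ₛ → ∀ x → (p *ₛ (q *ₛ x)) ≋ x
  *ₛ-cancel-inverse {p} {q} pq≋1 x =
    ≋-trans (≋-sym (L.*-assoc p q x)) (≋-trans (*ₛ-cong pq≋1 (≋-refl {x})) (L.*-identityˡ x))

  -- Coefficients of the inverse are solved for one at a time:
  -- w₀ = α₀⁻¹ and w_{k+1} = - α₀⁻¹ Σ_{t ≤ k} α_{t+1} w_{k-t}.
  module UnitInverse (u : LS) (u≥0 : u ≥ᵥ + 0) (u₀≢0 : coef u (+ 0) ≢ 0#) where
    open FSolver using (_:=_; _:+_; _:*_; :-_; _:-_; :0; :1)

    α : ℕ → Carrier
    α t = coef u (+ t)

    α₀⁻¹ : Carrier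
    α₀⁻¹ = proj₁ (inverse (α 0) u₀≢0)

    next : (ℕ → Carrier) → ℕ → Carrier
    next w k = - (α₀⁻¹ * sumTo k (λ t → α (suc t) * w (k ∸ t)))

    -- table k j is the final value of w j as soon as j ≤ k.
    table : ℕ → ℕ → Carrier
    extend : ∀ k j → Dec (j ℕ.≤ k) → Carrier
    table zero    j = α₀⁻¹
    table (suc k) j = extend k j (j ℕ.≤? k)
    extend k j (yes _) = table k j
    extend k j (no _)  = next (table k) k

    w : ℕ → Carrier
    w j = table j j

    extend-new : ∀ k j (j≤?k : Dec (j ℕ.≤ k)) → ¬ (j ℕ.≤ k) → extend k j j≤?k ≡ next (table k) k
    extend-new k j (yes j≤k) j≰k = contradiction j≤k j≰k
    extend-new k j (no _)    _   = refl

    table-stable : ∀ k j → j ℕ.≤ k → table k j ≡ w j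
    table-stable zero    zero    _     = refl
    table-stable (suc k) j       j≤1+k with j ℕ.≤? k
    ... | yes j≤k = table-stable k j j≤k
    ... | no  j≰k with ℕₚ.≤-antisym j≤1+k (ℕₚ.≰⇒> j≰k)
    ...   | refl = sym (extend-new k (suc k) (suc k ℕ.≤? k) j≰k)

    w-suc : ∀ k → w (suc k) ≡ next w k
    w-suc k = trans (extend-new k (suc k) (suc k ℕ.≤? k) (ℕₚ.<-irrefl refl))
      (cong (λ s → - (α₀⁻¹ * s)) (sumTo-cong k λ t _ → cong (_*_ (α (suc t))) (table-stable k (k ∸ t) (ℕₚ.m∸n≤m k t))))

    u⁻¹ : LS
    u⁻¹ = mkLS (+ 0) w

    u*u⁻¹≋1 : (u *ₛ u⁻¹) ≋ 1ₛ
    u*u⁻¹≋1 = ≋-trans (*ₛ-cong u≋normalised (≋-refl {u⁻¹})) (≋-pointwise refl λ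
      { zero    → proj₂ (inverse (α 0) u₀≢0)
      ; (suc k) → begin
          sumTo (suc k) (λ t → α t * w (suc k ∸ t))   ≡⟨ sumTo-suc k _ ⟩
          α 0 * w (suc k) + S k                       ≡⟨ cong (λ v → α 0 * v + S k) (w-suc k) ⟩
          α 0 * - (α₀⁻¹ * S k) + S k
            ≡⟨ FSolver.solve 3 (λ a b s → a :* :- (b :* s) :+ s := (:1 :- a :* b) :* s) refl (α 0) α₀⁻¹ (S k) ⟩
          (1# - α 0 * α₀⁻¹) * S k                     ≡⟨ cong (λ v → (1# - v) * S k) (proj₂ (inverse (α 0) u₀≢0)) ⟩
          (1# - 1#) * S k                             ≡⟨ FSolver.solve 1 (λ s → (:1 :- :1) :* s := :0) refl (S k) ⟩
          0#                                          ∎ })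
      where
      S : ℕ → Carrier
      S k = sumTo k (λ t → α (suc t) * w (k ∸ t))
      u≋normalised : u ≋ mkLS (+ 0) α
      u≋normalised = ≋-from (+ 0) u≥0 (coef-<lo (mkLS (+ 0) α)) (λ n → sym (coef-lo+ (mkLS (+ 0) α) n))

  -- Lattices in k_∞²

  infix 4 _≋ₘ_
  _≋ₘ_ : M2 → M2 → Set
  g ≋ₘ h = (a₁₁ g ≋ a₁₁ h) × (a₁₂ g ≋ a₁₂ h) × (a₂₁ g ≋ a₂₁ h) × (a₂₂ g ≋ a₂₂ h)

  Integral : M2 → Set
  Integral k = InO (a₁₁ k) × InO (a₁₂ k) × InO (a₂₁ k) × InO (a₂₂ k)

  ≋ᵥ-sym : ∀ {v w} → v ≋ᵥ w → w ≋ᵥ v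
  ≋ᵥ-sym (e₁ , e₂) = ≋-sym e₁ , ≋-sym e₂

  ≋ᵥ-trans : ∀ {u v w} → u ≋ᵥ v → v ≋ᵥ w → u ≋ᵥ w
  ≋ᵥ-trans (e₁ , e₂) (f₁ , f₂) = ≋-trans e₁ f₁ , ≋-trans e₂ f₂

  ·ᵥ-congˡ : ∀ {g h} v → g ≋ₘ h → (g ·ᵥ v) ≋ᵥ (h ·ᵥ v)
  ·ᵥ-congˡ (x , y) (e₁₁ , e₁₂ , e₂₁ , e₂₂) =
    +ₛ-cong (*ₛ-cong e₁₁ (≋-refl {x})) (*ₛ-cong e₁₂ (≋-refl {y})) ,
    +ₛ-cong (*ₛ-cong e₂₁ (≋-refl {x})) (*ₛ-cong e₂₂ (≋-refl {y}))

  ·ᵥ-·ₘ : ∀ g h v → ((g ·ₘ h) ·ᵥ v) ≋ᵥ (g ·ᵥ (h ·ᵥ v))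
  ·ᵥ-·ₘ g h (x , y) = row (a₁₁ g) (a₁₂ g) , row (a₂₁ g) (a₂₂ g)
    where
    open LSolver using (_:=_; _:+_; _:*_)
    row : ∀ p q → ((((p *ₛ a₁₁ h) +ₛ (q *ₛ a₂₁ h)) *ₛ x) +ₛ (((p *ₛ a₁₂ h) +ₛ (q *ₛ a₂₂ h)) *ₛ y))
                ≋ ((p *ₛ ((a₁₁ h *ₛ x) +ₛ (a₁₂ h *ₛ y))) +ₛ (q *ₛ ((a₂₁ h *ₛ x) +ₛ (a₂₂ h *ₛ y))))
    row p q = LSolver.solve 8 (λ p q a b c d x y →
      (p :* a :+ q :* c) :* x :+ (p :* b :+ q :* d) :* y := p :* (a :* x :+ b :* y) :+ q :* (c :* x :+ d :* y))
      ≋-refl p q (a₁₁ h) (a₁₂ h) (a₂₁ h) (a₂₂ h) x y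

  det-cong : ∀ {g h} → g ≋ₘ h → det g ≋ det h
  det-cong (e₁₁ , e₁₂ , e₂₁ , e₂₂) = L.+-cong (L.*-cong e₁₁ e₂₂) (L.-‿cong (L.*-cong e₁₂ e₂₁))

  det-·ₘ : ∀ g h → det (g ·ₘ h) ≋ (det g *ₛ det h)
  det-·ₘ (mat g₁₁ g₁₂ g₂₁ g₂₂) (mat h₁₁ h₁₂ h₂₁ h₂₂) = LSolver.solve 8 (λ g₁₁ g₁₂ g₂₁ g₂₂ h₁₁ h₁₂ h₂₁ h₂₂ →
    (g₁₁ :* h₁₁ :+ g₁₂ :* h₂₁) :* (g₂₁ :* h₁₂ :+ g₂₂ :* h₂₂) :- (g₁₁ :* h₁₂ :+ g₁₂ :* h₂₂) :* (g₂₁ :* h₁₁ :+ g₂₂ :* h₂₁)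
    := (g₁₁ :* g₂₂ :- g₁₂ :* g₂₁) :* (h₁₁ :* h₂₂ :- h₁₂ :* h₂₁)) ≋-refl g₁₁ g₁₂ g₂₁ g₂₂ h₁₁ h₁₂ h₂₁ h₂₂
    where open LSolver using (_:=_; _:+_; _:*_; _:-_)

  -- g O² ⊆ h O² exactly when g = h k for an integral matrix k.
  factor⇒InLat : ∀ {g h k w} → g ≋ₘ (h ·ₘ k) → Integral k → InLat g w → InLat h w
  factor⇒InLat {g} {h} {k} g≋hk (k₁₁∈O , k₁₂∈O , k₂₁∈O , k₂₂∈O) ((x , y) , x∈O , y∈O , gv≋w) =
    k ·ᵥ (x , y) ,
    ≥ᵥ-+ₛ (≥ᵥ-*ₛ {a₁₁ k} {x} k₁₁∈O x∈O) (≥ᵥ-*ₛ {a₁₂ k} {y} k₁₂∈O y∈O) ,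
    ≥ᵥ-+ₛ (≥ᵥ-*ₛ {a₂₁ k} {x} k₂₁∈O x∈O) (≥ᵥ-*ₛ {a₂₂ k} {y} k₂₂∈O y∈O) ,
    ≋ᵥ-trans (≋ᵥ-sym (·ᵥ-·ₘ h k (x , y))) (≋ᵥ-trans (·ᵥ-congˡ (x , y) (≋ₘ-sym g≋hk)) gv≋w)
    where
    ≋ₘ-sym : ∀ {g h} → g ≋ₘ h → h ≋ₘ g
    ≋ₘ-sym (e₁₁ , e₁₂ , e₂₁ , e₂₂) = ≋-sym e₁₁ , ≋-sym e₁₂ , ≋-sym e₂₁ , ≋-sym e₂₂

  InLat⇒factor : ∀ {g h} → (∀ w → InLat g w → InLat h w) → Σ M2 λ k → Integral k × g ≋ₘ (h ·ₘ k)
  InLat⇒factor {g} {h} g⊆h with g⊆h _ ((1ₛ , 0ₛ) , coef-<lo 1ₛ , coef-<lo 0ₛ , ≋-refl , ≋-refl)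
                              | g⊆h _ ((0ₛ , 1ₛ) , coef-<lo 0ₛ , coef-<lo 1ₛ , ≋-refl , ≋-refl)
  ... | (k₁₁ , k₂₁) , k₁₁∈O , k₂₁∈O , e₁₁ , e₂₁ | (k₁₂ , k₂₂) , k₁₂∈O , k₂₂∈O , e₁₂ , e₂₂ =
    mat k₁₁ k₁₂ k₂₁ k₂₂ , (k₁₁∈O , k₁₂∈O , k₂₁∈O , k₂₂∈O) ,
    ≋-trans (column₁ (a₁₁ g) (a₁₂ g)) (≋-sym e₁₁) , ≋-trans (column₂ (a₁₁ g) (a₁₂ g)) (≋-sym e₁₂) ,
    ≋-trans (column₁ (a₂₁ g) (a₂₂ g)) (≋-sym e₂₁) , ≋-trans (column₂ (a₂₁ g) (a₂₂ g)) (≋-sym e₂₂)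
    where
    open LSolver using (_:=_; _:+_; _:*_; :0; :1)
    column₁ : ∀ p q → p ≋ ((p *ₛ 1ₛ) +ₛ (q *ₛ 0ₛ))
    column₁ = LSolver.solve 2 (λ p q → p := p :* :1 :+ q :* :0) ≋-refl
    column₂ : ∀ p q → q ≋ ((p *ₛ 0ₛ) +ₛ (q *ₛ 1ₛ))
    column₂ = LSolver.solve 2 (λ p q → q := p :* :0 :+ q :* :1) ≋-refl

  SameLattice : M2 → M2 → Set
  SameLattice g h = ∀ w → InLat g w ⇔ InLat h w

  factor-unimodular : ∀ {g h k k'} → ¬ (det h ≋ 0ₛ) → g ≋ₘ (h ·ₘ k) → h ≋ₘ (g ·ₘ k') → (det k *ₛ det k') ≋ 1ₛ
  factor-unimodular {g} {h} {k} {k'} det-h≉0 g≋hk h≋gk' = *ₛ-cancelˡ det-h≉0 (≋R.begin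
    det h *ₛ (det k *ₛ det k')    ≋R.≈⟨ L.*-assoc (det h) (det k) (det k') ⟨
    (det h *ₛ det k) *ₛ det k'    ≋R.≈⟨ *ₛ-cong (≋-trans (det-cong g≋hk) (det-·ₘ h k)) (≋-refl {det k'}) ⟨
    det g *ₛ det k'               ≋R.≈⟨ ≋-trans (det-cong h≋gk') (det-·ₘ g k') ⟨
    det h                         ≋R.≈⟨ L.*-identityʳ (det h) ⟨
    det h *ₛ 1ₛ                   ≋R.∎)

  det-scaled-diagT : ∀ s n → det (scaleM s (diagT n)) ≋ ((s *ₛ s) *ₛ Tpow n)
  det-scaled-diagT s n = LSolver.solve 2 (λ s T →
    (s :* T) :* (s :* :1) :- (s :* :0) :* (s :* :0) := (s :* s) :* T) ≋-refl s (Tpow n)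
    where open LSolver using (_:=_; _:*_; _:-_; :0; :1)

  Integral⇒det≥0 : ∀ {k} → Integral k → det k ≥ᵥ + 0
  Integral⇒det≥0 {k} (k₁₁∈O , k₁₂∈O , k₂₁∈O , k₂₂∈O) =
    ≥ᵥ-+ₛ (≥ᵥ-*ₛ {a₁₁ k} {a₂₂ k} k₁₁∈O k₂₂∈O) (≥ᵥ--ₛ (≥ᵥ-*ₛ {a₁₂ k} {a₂₁ k} k₁₂∈O k₂₁∈O))

  -- The norm of k_{∞²}/k_∞

  -- norm x y is the norm x² - ε y² of x + y·i from k_{∞²} down to k_∞.
  norm : LS → LS → LS
  norm x y = (x *ₛ x) -ₛ (const ε *ₛ (y *ₛ y))

  ≥ᵥ-norm : ∀ {x y r} → x ≥ᵥ r → y ≥ᵥ r → norm x y ≥ᵥ r ℤ.+ r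
  ≥ᵥ-norm x≥r y≥r = ≥ᵥ-+ₛ (≥ᵥ-*ₛ x≥r x≥r)
    (≥ᵥ--ₛ (subst (_ ≥ᵥ_) (ℤₚ.+-identityˡ _) (≥ᵥ-*ₛ (coef-<lo (const ε)) (≥ᵥ-*ₛ y≥r y≥r))))

  coef-norm-leading : ∀ {x y r} → x ≥ᵥ r → y ≥ᵥ r →
                      coef (norm x y) (r ℤ.+ r) ≡ coef x r * coef x r - ε * (coef y r * coef y r)
  coef-norm-leading {x} {y} {r} x≥r y≥r = begin
    coef (norm x y) (r ℤ.+ r)
      ≡⟨ coef--ₛ-sub (x *ₛ x) (const ε *ₛ (y *ₛ y)) (r ℤ.+ r) ⟩
    coef (x *ₛ x) (r ℤ.+ r) - coef (const ε *ₛ (y *ₛ y)) (r ℤ.+ r)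
      ≡⟨ cong₂ _-_ (coef-*ₛ-leading x≥r x≥r) (cong (coef (const ε *ₛ (y *ₛ y))) (sym (ℤₚ.+-identityˡ (r ℤ.+ r)))) ⟩
    coef x r * coef x r - coef (const ε *ₛ (y *ₛ y)) (+ 0 ℤ.+ (r ℤ.+ r))
      ≡⟨ cong (λ v → coef x r * coef x r - v) (coef-*ₛ-leading (coef-<lo (const ε)) (≥ᵥ-*ₛ y≥r y≥r)) ⟩
    coef x r * coef x r - ε * coef (y *ₛ y) (r ℤ.+ r)
      ≡⟨ cong (λ v → coef x r * coef x r - ε * v) (coef-*ₛ-leading y≥r y≥r) ⟩
    coef x r * coef x r - ε * (coef y r * coef y r)
      ∎

  norm-cong : ∀ {x x' y y'} → x ≋ x' → y ≋ y' → norm x y ≋ norm x' y'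
  norm-cong x≋x' y≋y' = +ₛ-cong (*ₛ-cong x≋x' x≋x') (-ₛ-cong (*ₛ-cong (≋-refl {const ε}) (*ₛ-cong y≋y' y≋y')))

  norm-*ₛ : ∀ s x y → norm (s *ₛ x) (s *ₛ y) ≋ ((s *ₛ s) *ₛ norm x y)
  norm-*ₛ s x y = LSolver.solve 4 (λ s x y ε →
    (s :* x) :* (s :* x) :- ε :* ((s :* y) :* (s :* y)) := (s :* s) :* (x :* x :- ε :* (y :* y))) ≋-refl s x y (const ε)
    where open LSolver using (_:=_; _:*_; _:-_)

  -- For γ = (· · ; c d) and z = a + b·i, norm-j γ z is the norm of the automorphy
  -- factor j(γ, z) = c z + d; norm-j-i g is that of j(g, i).
  norm-j : M2 → K2 → LS
  norm-j γ (a , b) = norm (a₂₂ γ +ₛ (a₂₁ γ *ₛ a)) (a₂₁ γ *ₛ b)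

  norm-j-i : M2 → LS
  norm-j-i g = norm (a₂₂ g) (a₂₁ g)

  det≋im·norm-j-i : ∀ {g a b} → ActsI g (a , b) → det g ≋ (b *ₛ norm-j-i g)
  det≋im·norm-j-i {mat g₁₁ g₁₂ g₂₁ g₂₂} {a} {b} (g₁₂≋ , g₁₁≋) = ≋R.begin
    (g₁₁ *ₛ g₂₂) -ₛ (g₁₂ *ₛ g₂₁)
      ≋R.≈⟨ L.+-cong (*ₛ-cong g₁₁≋ (≋-refl {g₂₂})) (-ₛ-cong (*ₛ-cong g₁₂≋ (≋-refl {g₂₁}))) ⟨
    ((((a *ₛ g₂₁) +ₛ (b *ₛ g₂₂)) *ₛ g₂₂) -ₛ (((a *ₛ g₂₂) +ₛ (const ε *ₛ (b *ₛ g₂₁))) *ₛ g₂₁))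
      ≋R.≈⟨ LSolver.solve 5 (λ a b ε g₂₁ g₂₂ →
              (a :* g₂₁ :+ b :* g₂₂) :* g₂₂ :- (a :* g₂₂ :+ ε :* (b :* g₂₁)) :* g₂₁
              := b :* (g₂₂ :* g₂₂ :- ε :* (g₂₁ :* g₂₁))) ≋-refl a b (const ε) g₂₁ g₂₂ ⟩
    b *ₛ norm g₂₂ g₂₁ ≋R.∎
    where open LSolver using (_:=_; _:+_; _:*_; _:-_)

  -- The cocycle relation j(γg, i) = j(γ, g·i) j(g, i), after taking norms.
  norm-j-cocycle : ∀ {g a b} γ → ActsI g (a , b) → norm-j-i (γ ·ₘ g) ≋ (norm-j-i g *ₛ norm-j γ (a , b))
  norm-j-cocycle {mat g₁₁ g₁₂ g₂₁ g₂₂} {a} {b} (mat c₁₁ c₁₂ c₂₁ c₂₂) (g₁₂≋ , g₁₁≋) = ≋R.begin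
    norm ((c₂₁ *ₛ g₁₂) +ₛ (c₂₂ *ₛ g₂₂)) ((c₂₁ *ₛ g₁₁) +ₛ (c₂₂ *ₛ g₂₁))
      ≋R.≈⟨ norm-cong (L.+-cong (*ₛ-cong (≋-refl {c₂₁}) g₁₂≋) (≋-refl {c₂₂ *ₛ g₂₂}))
                      (L.+-cong (*ₛ-cong (≋-refl {c₂₁}) g₁₁≋) (≋-refl {c₂₂ *ₛ g₂₁})) ⟨
    norm ((c₂₁ *ₛ ((a *ₛ g₂₂) +ₛ (const ε *ₛ (b *ₛ g₂₁)))) +ₛ (c₂₂ *ₛ g₂₂))
         ((c₂₁ *ₛ ((a *ₛ g₂₁) +ₛ (b *ₛ g₂₂))) +ₛ (c₂₂ *ₛ g₂₁))
      ≋R.≈⟨ LSolver.solve 7 (λ a b ε c d g₂₁ g₂₂ →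
              let x = c :* (a :* g₂₂ :+ ε :* (b :* g₂₁)) :+ d :* g₂₂
                  y = c :* (a :* g₂₁ :+ b :* g₂₂) :+ d :* g₂₁
                  u = d :+ c :* a
                  v = c :* b
              in x :* x :- ε :* (y :* y)
                 := (g₂₂ :* g₂₂ :- ε :* (g₂₁ :* g₂₁)) :* (u :* u :- ε :* (v :* v)))
            ≋-refl a b (const ε) c₂₁ c₂₂ g₂₁ g₂₂ ⟩
    norm g₂₂ g₂₁ *ₛ norm-j (mat c₁₁ c₁₂ c₂₁ c₂₂) (a , b) ≋R.∎
    where open LSolver using (_:=_; _:+_; _:*_; _:-_)

  -- The vertex λ̄(z)

  hasVal-minus-re : ∀ {a b e} → HasValₛ b e → HasVal ((a , b) -₂ emb a) e
  hasVal-minus-re {a} {b} {e} (b≢0 , b≥e) =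
    (λ (_ , b-0≡0) → b≢0 (trans (sym (b-0≋b e)) b-0≡0)) , λ k k<e → a-a≋0 k , trans (b-0≋b k) (b≥e k k<e)
    where
    a-a≋0 : ∀ k → coef (a -ₛ a) k ≡ 0#
    a-a≋0 k = trans (L.-‿inverseʳ a k) (coef-0ₛ k)
    b-0≋b : (b -ₛ 0ₛ) ≋ b
    b-0≋b = LSolver.solve 1 (λ b → b :- :0 := b) ≋-refl b
      where open LSolver using (_:=_; _:-_; :0)

  -- |z| = |z|_i for z = a + b·i ∉ k_∞ forces |a| ≤ |b| = |z|: otherwise a ∈ k_∞ would be closer
  -- to z than |z|_i.
  imaginary-part-dominates : ∀ {a b m} → ¬ InKinf (a , b) → HasVal (a , b) m → IsImagVal (a , b) m →
                             a ≥ᵥ m × HasValₛ b m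
  imaginary-part-dominates {a} {b} {m} z∉k∞ (_ , z≥m) (_ , maximal) = a≥m , bₘ≢0 , b≥m
    where
    a≥m : a ≥ᵥ m
    a≥m k k<m = proj₁ (z≥m k k<m)
    b≥m : b ≥ᵥ m
    b≥m k k<m = proj₂ (z≥m k k<m)
    bₘ≢0 : coef b m ≢ 0#
    bₘ≢0 bₘ≡0 = ≋0⊎hasVal b λ
      { (inj₁ b≋0)         → z∉k∞ (a , ≋-refl , b≋0)
      ; (inj₂ (m' , vb')) → proj₁ vb' (subst (λ i → coef b i ≡ 0#) (ℤₚ.≤-antisym
          (ℤₚ.≮⇒≥ λ m'<m → proj₁ vb' (b≥m m' m'<m)) (maximal a m' (hasVal-minus-re vb'))) bₘ≡0) }

  1ₘ : M2
  1ₘ = mat 1ₛ 0ₛ 0ₛ 1ₛ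

  1ₘ∈GL2A : GL2A 1ₘ
  1ₘ∈GL2A = 1∈A , 0∈A , 0∈A , 1∈A , 1# , (λ 1≡0 → 0≢1 (sym 1≡0)) ,
            LSolver.solve 0 (:1 :* :1 :- :0 :* :0 := :1) ≋-refl
    where
    open LSolver using (_:=_; _:*_; _:-_; :0; :1)
    1∈A : InA 1ₛ
    1∈A k 0<k = coef-const 1# k (λ k≡0 → ℤₚ.<-irrefl (sym k≡0) 0<k)
    0∈A : InA 0ₛ
    0∈A k _ = coef-0ₛ k

  1ₛ≉0 : ¬ (1ₛ ≋ 0ₛ)
  1ₛ≉0 = hasVal⇒≉0 (hasVal-const (λ 1≡0 → 0≢1 (sym 1≡0)))

  -- g = (b a ; 0 1) = diag(T^n,1)·(u v ; 0 1) with u = T^{-n} b ∈ O_∞^× and v = T^{-n} a ∈ O_∞.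
  module UpperTriangular (a b : LS) (m : ℤ) (n : ℕ)
                         (a≥m : a ≥ᵥ m) (vb : HasValₛ b m) (n+m≡0 : + n ℤ.+ m ≡ + 0) where
    open LSolver using (_:=_; _:+_; _:*_; :-_; _:-_; :0; :1)

    g : M2
    g = mat b a 0ₛ 1ₛ

    det-g≋b : det g ≋ b
    det-g≋b = LSolver.solve 2 (λ b a → b :* :1 :- a :* :0 := b) ≋-refl b a

    g·i≡z : ActsI g (a , b)
    g·i≡z = LSolver.solve 3 (λ a b ε → a :* :1 :+ ε :* (b :* :0) := a) ≋-refl a b (const ε)
          , LSolver.solve 2 (λ a b → a :* :0 :+ b :* :1 := b) ≋-refl a b

    T u v : LS
    T = Tpow n
    u = Tneg n *ₛ b
    v = Tneg n *ₛ a

    vu : HasValₛ u (+ 0)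
    vu = subst (HasValₛ u) n+m≡0 (hasVal-*ₛ (hasVal-Tneg n) vb)

    v≥0 : v ≥ᵥ + 0
    v≥0 = subst (v ≥ᵥ_) n+m≡0 (≥ᵥ-*ₛ (coef-<lo (Tneg n)) a≥m)

    open UnitInverse u (proj₂ vu) (proj₁ vu) using (u⁻¹; u*u⁻¹≋1)

    h' k k' : M2
    h' = scaleM 1ₛ (diagT n)
    k  = mat u v 0ₛ 1ₛ
    k' = mat u⁻¹ (-ₛ (u⁻¹ *ₛ v)) 0ₛ 1ₛ

    k∈O : Integral k
    k∈O = proj₂ vu , v≥0 , coef-<lo 0ₛ , coef-<lo 1ₛ

    k'∈O : Integral k'
    k'∈O = coef-<lo u⁻¹ , ≥ᵥ--ₛ (≥ᵥ-*ₛ {u⁻¹} {v} (coef-<lo u⁻¹) v≥0) , coef-<lo 0ₛ , coef-<lo 1ₛ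

    T[Tneg·x]≋x : ∀ x → (T *ₛ (Tneg n *ₛ x)) ≋ x
    T[Tneg·x]≋x = *ₛ-cancel-inverse {T} {Tneg n} (Tpow*Tneg n)

    bu⁻¹≋T : (b *ₛ u⁻¹) ≋ T
    bu⁻¹≋T = ≋R.begin
      b *ₛ u⁻¹                        ≋R.≈⟨ *ₛ-cong (T[Tneg·x]≋x b) (≋-refl {u⁻¹}) ⟨
      (T *ₛ u) *ₛ u⁻¹                 ≋R.≈⟨ L.*-assoc T u u⁻¹ ⟩
      T *ₛ (u *ₛ u⁻¹)                 ≋R.≈⟨ *ₛ-cong (≋-refl {T}) u*u⁻¹≋1 ⟩
      T *ₛ 1ₛ                         ≋R.≈⟨ L.*-identityʳ T ⟩
      T                               ≋R.∎

    1g≋h'k : (1ₘ ·ₘ g) ≋ₘ (h' ·ₘ k)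
    1g≋h'k = top b u 0ₛ (T[Tneg·x]≋x b) , top a v 1ₛ (T[Tneg·x]≋x a) ,
             LSolver.solve 2 (λ b u → :0 :* b :+ :1 :* :0 := (:1 :* :0) :* u :+ (:1 :* :1) :* :0) ≋-refl b u ,
             LSolver.solve 2 (λ a v → :0 :* a :+ :1 :* :1 := (:1 :* :0) :* v :+ (:1 :* :1) :* :1) ≋-refl a v
      where
      top : ∀ x y z → (T *ₛ y) ≋ x → ((1ₛ *ₛ x) +ₛ (0ₛ *ₛ z)) ≋ (((1ₛ *ₛ T) *ₛ y) +ₛ ((1ₛ *ₛ 0ₛ) *ₛ z))
      top x y z Ty≋x = ≋-trans (LSolver.solve 2 (λ x z → :1 :* x :+ :0 :* z := x) ≋-refl x z)
        (≋-trans (≋-sym Ty≋x) (LSolver.solve 3 (λ T y z → T :* y := (:1 :* T) :* y :+ (:1 :* :0) :* z) ≋-refl T y z))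

    h'≋1gk' : h' ≋ₘ ((1ₘ ·ₘ g) ·ₘ k')
    h'≋1gk' = entry₁₁ , entry₁₂ ,
      LSolver.solve 3 (λ b a u⁻¹ → :1 :* :0 := (:0 :* b :+ :1 :* :0) :* u⁻¹ :+ (:0 :* a :+ :1 :* :1) :* :0)
        ≋-refl b a u⁻¹ ,
      LSolver.solve 3 (λ b a w → :1 :* :1 := (:0 :* b :+ :1 :* :0) :* w :+ (:0 :* a :+ :1 :* :1) :* :1)
        ≋-refl b a (-ₛ (u⁻¹ *ₛ v))
      where
      entry₁₁ : (1ₛ *ₛ T) ≋ ((((1ₛ *ₛ b) +ₛ (0ₛ *ₛ 0ₛ)) *ₛ u⁻¹) +ₛ (((1ₛ *ₛ a) +ₛ (0ₛ *ₛ 1ₛ)) *ₛ 0ₛ))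
      entry₁₁ = ≋R.begin
        1ₛ *ₛ T      ≋R.≈⟨ L.*-identityˡ T ⟩
        T            ≋R.≈⟨ bu⁻¹≋T ⟨
        b *ₛ u⁻¹
          ≋R.≈⟨ LSolver.solve 3 (λ b a u⁻¹ → b :* u⁻¹ := (:1 :* b :+ :0 :* :0) :* u⁻¹ :+ (:1 :* a :+ :0 :* :1) :* :0)
                  ≋-refl b a u⁻¹ ⟩
        (((1ₛ *ₛ b) +ₛ (0ₛ *ₛ 0ₛ)) *ₛ u⁻¹) +ₛ (((1ₛ *ₛ a) +ₛ (0ₛ *ₛ 1ₛ)) *ₛ 0ₛ) ≋R.∎
      entry₁₂ : (1ₛ *ₛ 0ₛ) ≋ ((((1ₛ *ₛ b) +ₛ (0ₛ *ₛ 0ₛ)) *ₛ (-ₛ (u⁻¹ *ₛ v))) +ₛ (((1ₛ *ₛ a) +ₛ (0ₛ *ₛ 1ₛ)) *ₛ 1ₛ))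
      entry₁₂ = ≋-sym (≋R.begin
        (((1ₛ *ₛ b) +ₛ (0ₛ *ₛ 0ₛ)) *ₛ (-ₛ (u⁻¹ *ₛ v))) +ₛ (((1ₛ *ₛ a) +ₛ (0ₛ *ₛ 1ₛ)) *ₛ 1ₛ)
          ≋R.≈⟨ LSolver.solve 4 (λ b a u⁻¹ v → (:1 :* b :+ :0 :* :0) :* (:- (u⁻¹ :* v)) :+ (:1 :* a :+ :0 :* :1) :* :1
                                               := a :- (b :* u⁻¹) :* v) ≋-refl b a u⁻¹ v ⟩
        a -ₛ ((b *ₛ u⁻¹) *ₛ v)   ≋R.≈⟨ L.+-cong (≋-refl {a}) (-ₛ-cong (*ₛ-cong bu⁻¹≋T (≋-refl {v}))) ⟩
        a -ₛ (T *ₛ v)            ≋R.≈⟨ L.+-cong (≋-refl {a}) (-ₛ-cong (T[Tneg·x]≋x a)) ⟩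
        a -ₛ a                   ≋R.≈⟨ L.-‿inverseʳ a ⟩
        0ₛ                       ≋R.≈⟨ L.zeroʳ 1ₛ ⟨
        1ₛ *ₛ 0ₛ                 ≋R.∎)

    same-lattice : SameLattice (1ₘ ·ₘ g) h'
    same-lattice w =
      mk⇔ (factor⇒InLat {1ₘ ·ₘ g} {h'} {k} 1g≋h'k k∈O) (factor⇒InLat {h'} {1ₘ ·ₘ g} {k'} h'≋1gk' k'∈O)

  n≡-m⇒λbar : ∀ {a b m n} → a ≥ᵥ m → HasValₛ b m → + n ≡ ℤ.- m → LambdaBarIs (a , b) n
  n≡-m⇒λbar {a} {b} {m} {n} a≥m vb n≡-m =
    g , hasVal⇒≉0 (hasVal-resp-≋ (≋-sym det-g≋b) vb) , g·i≡z , 1ₘ , 1ₘ∈GL2A , 1ₛ , 1ₛ≉0 , same-lattice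
    where open UpperTriangular a b m n a≥m vb (trans (cong (ℤ._+ m) n≡-m) (ℤₚ.+-inverseˡ m))

  module _ (ε-nonsquare : ∀ x → x * x ≢ ε) where

    -- Anisotropy: the leading terms of x² and ε y² never cancel.
    hasVal-norm : ∀ {x y r} → x ≥ᵥ r → y ≥ᵥ r → ¬ (coef x r ≡ 0# × coef y r ≡ 0#) → HasValₛ (norm x y) (r ℤ.+ r)
    hasVal-norm x≥r y≥r ¬both0 =
      (λ N≡0 → ¬both0 (anisotropic ε-nonsquare _ _ (trans (sym (coef-norm-leading x≥r y≥r)) N≡0))) , ≥ᵥ-norm x≥r y≥r

    hasVal-norm≤ : ∀ {x y f e} → HasValₛ y f → HasValₛ (norm x y) e → e ℤ.≤ f ℤ.+ f
    hasVal-norm≤ {x} {y} {f} {e} (y≢0 , y≥f) vN = decidable-stable (e ℤₚ.≤? f ℤ.+ f) do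
      no x≱f ← ¬¬-excluded-middle
        where yes x≥f → pure (ℤₚ.≤-reflexive (hasVal-unique vN (hasVal-norm x≥f y≥f (y≢0 ∘ proj₂))))
      inj₂ (r , x≢0 , x≥r) ← ≋0⊎hasVal x
        where inj₁ x≋0 → contradiction (λ k _ → trans (x≋0 k) (coef-0ₛ k)) x≱f
      let r<f = ℤₚ.≰⇒> (λ f≤r → x≱f (≥ᵥ-weaken f≤r x≥r))
      pure (subst (ℤ._≤ f ℤ.+ f) (hasVal-unique (hasVal-norm x≥r (≥ᵥ-weaken (ℤₚ.<⇒≤ r<f) y≥f) (x≢0 ∘ proj₁)) vN)
                  (ℤₚ.+-mono-≤ (ℤₚ.<⇒≤ r<f) (ℤₚ.<⇒≤ r<f)))

    -- The bottom row of k ∈ GL₂(O_∞) is primitive: det k ≢ 0 mod T⁻¹.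
    hasVal-norm-bottom-row : ∀ {k} → Integral k → HasValₛ (det k) (+ 0) → HasValₛ (norm-j-i k) (+ 0)
    hasVal-norm-bottom-row {k} (k₁₁∈O , k₁₂∈O , k₂₁∈O , k₂₂∈O) (det₀≢0 , _) =
      hasVal-norm k₂₂∈O k₂₁∈O λ (k₂₂₀≡0 , k₂₁₀≡0) → det₀≢0 (begin
        coef (det k) (+ 0)
          ≡⟨ coef--ₛ-sub (a₁₁ k *ₛ a₂₂ k) (a₁₂ k *ₛ a₂₁ k) (+ 0) ⟩
        coef (a₁₁ k *ₛ a₂₂ k) (+ 0) - coef (a₁₂ k *ₛ a₂₁ k) (+ 0)
          ≡⟨ cong₂ _-_ (coef-*ₛ-leading k₁₁∈O k₂₂∈O) (coef-*ₛ-leading k₁₂∈O k₂₁∈O) ⟩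
        coef (a₁₁ k) (+ 0) * coef (a₂₂ k) (+ 0) - coef (a₁₂ k) (+ 0) * coef (a₂₁ k) (+ 0)
          ≡⟨ cong₂ (λ u v → coef (a₁₁ k) (+ 0) * u - coef (a₁₂ k) (+ 0) * v) k₂₂₀≡0 k₂₁₀≡0 ⟩
        coef (a₁₁ k) (+ 0) * 0# - coef (a₁₂ k) (+ 0) * 0#
          ≡⟨ FSolver.solve 2 (λ p q → p :* :0 :- q :* :0 := :0) refl _ _ ⟩
        0# ∎)
      where open FSolver using (_:=_; _:*_; _:-_; :0)

    -- Both valuations are read off from h = s·diag(T^n,1)·k: they are 2v(s) - n and 2v(s).
    height-from-factors : ∀ {h s n k k'} → Integral k → Integral k' →
      h ≋ₘ (scaleM s (diagT n) ·ₘ k) → scaleM s (diagT n) ≋ₘ (h ·ₘ k') → ∀ {σ} → HasValₛ s σ →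
      ∃ λ D → HasValₛ (det h) D × HasValₛ (norm-j-i h) (D ℤ.+ + n)
    height-from-factors {h} {s} {n} {k} {k'} k∈O k'∈O h≋h'k@(_ , _ , h₂₁≋ , h₂₂≋) h'≋hk' {σ} vs =
      _ , vdet-h , subst (HasValₛ (norm-j-i h)) (height-index (σ ℤ.+ σ) (+ n)) vnorm-h
      where
      h' : M2
      h' = scaleM s (diagT n)

      vdet-h' : HasValₛ (det h') ((σ ℤ.+ σ) ℤ.+ ℤ.- (+ n))
      vdet-h' = hasVal-resp-≋ (≋-sym (det-scaled-diagT s n)) (hasVal-*ₛ (hasVal-*ₛ vs vs) (hasVal-Tpow n))

      vdet-k : HasValₛ (det k) (+ 0)
      vdet-k = unitᴼ⇒hasVal0 (Integral⇒det≥0 {k} k∈O) (Integral⇒det≥0 {k'} k'∈O)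
                             (factor-unimodular {h} {h'} {k} {k'} (hasVal⇒≉0 vdet-h') h≋h'k h'≋hk')

      vdet-h : HasValₛ (det h) (((σ ℤ.+ σ) ℤ.+ ℤ.- (+ n)) ℤ.+ + 0)
      vdet-h = hasVal-resp-≋ (≋-sym (≋-trans (det-cong {h} {h' ·ₘ k} h≋h'k) (det-·ₘ h' k))) (hasVal-*ₛ vdet-h' vdet-k)

      bottom-row : norm-j-i h ≋ ((s *ₛ s) *ₛ norm-j-i k)
      bottom-row = ≋-trans (norm-cong (≋-trans h₂₂≋ (s·e₂ (a₁₂ k) (a₂₂ k))) (≋-trans h₂₁≋ (s·e₂ (a₁₁ k) (a₂₁ k))))
                           (norm-*ₛ s (a₂₂ k) (a₂₁ k))
        where
        open LSolver using (_:=_; _:+_; _:*_; :0; :1)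
        s·e₂ : ∀ p q → (((s *ₛ 0ₛ) *ₛ p) +ₛ ((s *ₛ 1ₛ) *ₛ q)) ≋ (s *ₛ q)
        s·e₂ = LSolver.solve 3 (λ s p q → (s :* :0) :* p :+ (s :* :1) :* q := s :* q) ≋-refl s

      vnorm-h : HasValₛ (norm-j-i h) ((σ ℤ.+ σ) ℤ.+ + 0)
      vnorm-h = hasVal-resp-≋ (≋-sym bottom-row) (hasVal-*ₛ (hasVal-*ₛ vs vs) (hasVal-norm-bottom-row {k} k∈O vdet-k))

      height-index : ∀ S m → S ℤ.+ + 0 ≡ ((S ℤ.+ ℤ.- m) ℤ.+ + 0) ℤ.+ m
      height-index = ℤ-Solver.solve-∀

    lattice-height : ∀ {h s n} → ¬ (s ≋ 0ₛ) → SameLattice h (scaleM s (diagT n)) →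
                     DoubleNegation (∃ λ D → HasValₛ (det h) D × HasValₛ (norm-j-i h) (D ℤ.+ + n))
    lattice-height {h} {s} {n} s≉0 h~h' = do
      (σ , vs) ← hasVal-exists s s≉0
      let (k , k∈O , h≋h'k)   = InLat⇒factor {h} {scaleM s (diagT n)} (λ w → Equivalence.to (h~h' w))
          (k' , k'∈O , h'≋hk') = InLat⇒factor {scaleM s (diagT n)} {h} (λ w → Equivalence.from (h~h' w))
      pure (height-from-factors {h} {s} {n} {k} {k'} k∈O k'∈O h≋h'k h'≋hk' vs)

    -- For c = 0, d is a unit of A, hence a constant, and |c z + d| = 1.
    norm-j-upper-triangular : ∀ {c₁₁ c₁₂ c₂₁ c₂₂ a b V} → GL2A (mat c₁₁ c₁₂ c₂₁ c₂₂) → c₂₁ ≋ 0ₛ →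
                              HasValₛ (norm-j (mat c₁₁ c₁₂ c₂₁ c₂₂) (a , b)) V → DoubleNegation (V ≡ + 0)
    norm-j-upper-triangular {c₁₁} {c₁₂} {c₂₁} {c₂₂} {a} {b} (c₁₁∈A , _ , _ , c₂₂∈A , u , u≢0 , detγ≋u) c₂₁≋0 vV = do
      (e₁ , vc₁₁) ← hasVal-exists c₁₁ λ c₁₁≋0 → hasVal⇒≉0 vc₁₁c₂₂ (≋-trans (*ₛ-cong c₁₁≋0 (≋-refl {c₂₂})) (L.zeroˡ c₂₂))
      (e₂ , vc₂₂) ← hasVal-exists c₂₂ λ c₂₂≋0 → hasVal⇒≉0 vc₁₁c₂₂ (≋-trans (*ₛ-cong (≋-refl {c₁₁}) c₂₂≋0) (L.zeroʳ c₁₁))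
      let e₂≡0 = nonpos-sum-zero (InA∧hasVal⇒≤0 c₁₁∈A vc₁₁) (InA∧hasVal⇒≤0 c₂₂∈A vc₂₂)
                                 (hasVal-unique (hasVal-*ₛ vc₁₁ vc₂₂) vc₁₁c₂₂)
      pure (hasVal-unique vV (hasVal-resp-≋ (≋-sym norm-j≋d²)
                                            (subst (λ e → HasValₛ (c₂₂ *ₛ c₂₂) (e ℤ.+ e)) e₂≡0 (hasVal-*ₛ vc₂₂ vc₂₂))))
      where
      open LSolver using (_:=_; _:+_; _:*_; _:-_; :0)
      vc₁₁c₂₂ : HasValₛ (c₁₁ *ₛ c₂₂) (+ 0)
      vc₁₁c₂₂ = hasVal-resp-≋ (≋-sym (≋-trans (≋-sym det≋c₁₁c₂₂) detγ≋u)) (hasVal-const u≢0)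
        where
        det≋c₁₁c₂₂ : det (mat c₁₁ c₁₂ c₂₁ c₂₂) ≋ (c₁₁ *ₛ c₂₂)
        det≋c₁₁c₂₂ = ≋-trans (L.+-cong (≋-refl {c₁₁ *ₛ c₂₂}) (-ₛ-cong (*ₛ-cong (≋-refl {c₁₂}) c₂₁≋0)))
          (LSolver.solve 3 (λ p q r → p :* r :- q :* :0 := p :* r) ≋-refl c₁₁ c₁₂ c₂₂)
      norm-j≋d² : norm-j (mat c₁₁ c₁₂ c₂₁ c₂₂) (a , b) ≋ (c₂₂ *ₛ c₂₂)
      norm-j≋d² =
        ≋-trans (norm-cong (L.+-cong (≋-refl {c₂₂}) (*ₛ-cong c₂₁≋0 (≋-refl {a}))) (*ₛ-cong c₂₁≋0 (≋-refl {b})))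
        (LSolver.solve 4 (λ d a b ε → (d :+ :0 :* a) :* (d :+ :0 :* a) :- ε :* ((:0 :* b) :* (:0 :* b)) := d :* d)
                         ≋-refl c₂₂ a b (const ε))

    -- In valuations: |c z + d| = 1, or |c z + d| ≥ |c| |Im z| ≥ |Im z|.
    norm-j-bound : ∀ {γ a b m V} → GL2A γ → HasValₛ b m → HasValₛ (norm-j γ (a , b)) V →
                   DoubleNegation (V ≡ + 0 ⊎ V ℤ.≤ m ℤ.+ m)
    norm-j-bound {mat c₁₁ c₁₂ c₂₁ c₂₂} {a} {b} {m} {V} γ∈GL2A@(_ , _ , c₂₁∈A , _) vb vV = do
      inj₂ (f , vc₂₁) ← ≋0⊎hasVal c₂₁
        where inj₁ c₂₁≋0 → ¬¬-map inj₁ (norm-j-upper-triangular {a = a} {b} γ∈GL2A c₂₁≋0 vV)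
      let V≤2[f+m] = hasVal-norm≤ {c₂₂ +ₛ (c₂₁ *ₛ a)} (hasVal-*ₛ vc₂₁ vb) vV
      pure (inj₂ (ℤₚ.≤-trans V≤2[f+m] (double-≤ (f+m≤m m (InA∧hasVal⇒≤0 c₂₁∈A vc₂₁)))))

    λbar⇒n≡-m : ∀ {a b m n} → HasValₛ b m → m ℤ.≤ + 0 → LambdaBarIs (a , b) n → + n ≡ ℤ.- m
    λbar⇒n≡-m {a} {b} {m} {n} vb m≤0
              (g , det-g≉0 , g·i≡z , γ , γ∈GL2A@(_ , _ , _ , _ , _ , u≢0 , detγ≋u) , s , s≉0 , same) =
      decidable-stable (+ n ℤₚ.≟ ℤ.- m) do
        (E , vE) ← hasVal-exists (norm-j-i g) λ N≋0 →
          det-g≉0 (≋-trans (det≋im·norm-j-i {g} {a} {b} g·i≡z) (≋-trans (*ₛ-cong (≋-refl {b}) N≋0) (L.zeroʳ b)))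
        (D , vdet , vnorm) ← lattice-height {γ ·ₘ g} s≉0 same
        let vdet' = hasVal-resp-≋ (≋-sym (≋-trans (det-·ₘ γ g) (*ₛ-cong detγ≋u (det≋im·norm-j-i {g} {a} {b} g·i≡z))))
                                  (hasVal-*ₛ (hasVal-const u≢0) (hasVal-*ₛ vb vE))
            vj    = hasVal-cancelˡ vE (subst (HasValₛ _) (D+n≡E+[m+n] (hasVal-unique vdet vdet'))
                                              (hasVal-resp-≋ (norm-j-cocycle {g} {a} {b} γ g·i≡z) vnorm))
        bound ← norm-j-bound {γ} {a} γ∈GL2A vb vj
        pure (n≡-m-from-bound m n m≤0 bound)
      where
      D+n≡E+[m+n] : ∀ {D E} → D ≡ + 0 ℤ.+ (m ℤ.+ E) → D ℤ.+ + n ≡ E ℤ.+ (m ℤ.+ + n)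
      D+n≡E+[m+n] {D} {E} refl = shuffle m E (+ n)
        where shuffle : ∀ m E n → + 0 ℤ.+ (m ℤ.+ E) ℤ.+ n ≡ E ℤ.+ (m ℤ.+ n)
              shuffle = ℤ-Solver.solve-∀

open import Data.Integer using (_≤_; -_)

mainTheorem8 : (F : FiniteOddField) (ε : FiniteOddField.Carrier F)
    → (∀ x → FiniteOddField._*_ F x x ≢ ε)
    → let open Over F ε in
      (z : K2) (m : ℤ)
    → ¬ InKinf z → HasVal z m → IsImagVal z m → m ≤ + 0
    → (n : ℕ) → (LambdaBarIs z n ⇔ (+ n ≡ - m))
mainTheorem8 F ε ε-nonsquare (a , b) m z∉k∞ vz iv m≤0 n =
  let (a≥m , vb) = imaginary-part-dominates F ε {a} {b} {m} z∉k∞ vz iv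
  in mk⇔ (λbar⇒n≡-m F ε ε-nonsquare {a} {b} {m} {n} vb m≤0) (n≡-m⇒λbar F ε {a} {b} {m} {n} a≥m vb)
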